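{- Let $m,n,r>0$ be integers with $r\le\min(m,n)$, and let $\mathbf{X}=(x_{i,k})\in\mathbb{F}_q^{m\times r}$ and $\mathbf{Y}=(y_{k,j})\in\mathbb{F}_q^{r\times n}$ be independent uniformly random matrices. For every $\mathcal{A}\subseteq\mathbb{F}_q$, $$\operatorname{ct}_{\mathcal{A}}(\mathbf{X}\mathbf{Y})=\mu_{\mathcal{A}}(q,m,n)+\sum_{\mathcal{S}\subseteq[r]}\sum_{\chi_{\mathcal{S}}\in\widehat{\mathbb{F}_q^*}^{|\mathcal{S}|}}\sum_{a\in\mathcal{A}}\widehat{f^{(a)}_{\mathcal{S}}}(\chi_{\mathcal{S}})\big(X_{\mathcal{S},\chi}-\mathbb{E}[X_{\mathcal{S},\chi}]\big)\big(Y_{\mathcal{S},\chi}-\mathbb{E}[Y_{\mathcal{S},\chi}]\big)-\gamma_{\mathcal{A}}(q)\,n\big(Z-\mathbb{E}[Z]\big)-\gamma_{\mathcal{A}}(q)\,m\big(W-\mathbb{E}[W]\big).$$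
   Context: $\mathbb{F}_q$ is a finite field with $q$ elements, $[r]=\{1,\dots,r\}$. $\operatorname{ct}_{\mathcal{A}}(\mathbf{N})$ is the number of entries of the matrix $\mathbf{N}$ lying in $\mathcal{A}$. $\gamma_0(q):=q^{ -1}-1$, $\gamma_a(q):=q^{ -1}$ for $a\ne0$, $\gamma_{\mathcal{A}}(q):=\sum_{a\in\mathcal{A}}\gamma_a(q)$, $\mu_{\mathcal{A}}(q,m,n):=(|\mathcal{A}|q^{ -1}-\gamma_{\mathcal{A}}(q)q^{ -r})mn$. $\widehat{\mathbb{F}_q^*}$ is the set of multiplicative characters of $\mathbb{F}_q$, each extended by $\chi(0):=0$; $\chi_0$ is the trivial one. For $\mathcal{S}\subseteq[r]$ with elements $k_1<\dots<k_{|\mathcal{S}|}$, $\chi_{\mathcal{S}}=(\chi_{k_1},\dots,\chi_{k_{|\mathcal{S}|}})$ and $a_{\mathcal{S}}$ analogously; for $\mathcal{T}\subseteq[r]$, $a_{(\mathcal{T})}$ is the $r$-tuple with $k$-th entry $a_k$ if $k\in\mathcal{T}$ and $0$ otherwise. Empty products equal $1$. $f^{(a)}:\mathbb{F}_q^r\to\mathbb{C}$ is the indicator of $\sum_{k=1}^r a_k=a$; $f^{(a)}_{\mathcal{S}}(a_{\mathcal{S}}):=\sum_{\mathcal{T}\subseteq\mathcal{S}}(-1)^{|\mathcal{S}\setminus\mathcal{T}|}f^{(a)}(a_{(\mathcal{T})})$; for $g:\mathbb{F}_q^t\to\mathbb{C}$, $\widehat{g}(\chi_1,\dots,\chi_t):=\frac{1}{(q-1)^t}\sum_{a_1,\dots,a_t\in\mathbb{F}_q}g(a_1,\dots,a_t)\overline{\chi_1}(a_1)\cdots\overline{\chi_t}(a_t)$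 (for $t=0$, the value of $g$ at the empty tuple). Random variables: $X_{\mathcal{S},\chi}:=\sum_{i=1}^m\prod_{k\in\mathcal{S}}\chi_k(x_{i,k})$, $Y_{\mathcal{S},\chi}:=\sum_{j=1}^n\prod_{k\in\mathcal{S}}\chi_k(y_{k,j})$, $Z:=\sum_{i=1}^m\prod_{k=1}^r(1-\chi_0(x_{i,k}))$, $W:=\sum_{j=1}^n\prod_{k=1}^r(1-\chi_0(y_{k,j}))$. -}

module Defs where

open import Data.Nat as ℕ using (ℕ; zero; suc; _∸_)
open import Data.Fin as Fin using (Fin)
open import Data.Bool using (Bool; true; false; if_then_else_)
open import Data.List as L using (List; []; _∷_; [_]; map; concatMap; foldr; allFin; length)
open import Data.Nat.ListAction using () renaming (sum to sumℕ)
open import Data.List.Relation.Unary.All using (All)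
open import Data.List.Relation.Unary.Any using (Any)
open import Data.List.Relation.Unary.AllPairs using (AllPairs)
open import Data.Vec as V using (Vec; []; _∷_; lookup; tabulate)
open import Data.Product using (Σ; ∃; _×_; _,_)
open import Relation.Binary.PropositionalEquality using (_≡_; _≢_)
open import Relation.Binary.Definitions using (DecidableEquality)
open import Relation.Nullary using (¬_; yes; no)
open import Algebra.Core using (Op₁; Op₂)
open import Algebra.Structures using (IsCommutativeRing)
open import Function.Bundles using (_↔_; Inverse)

record FiniteField : Set₁ where
  field
    Carrier : Set
    _+_ _*_ : Op₂ Carrier
    -_ : Op₁ Carrier
    0# 1# : Carrier
    isCommutativeRing : IsCommutativeRing _≡_ _+_ _*_ -_ 0# 1#
    0≢1 : 0# ≢ 1#
    inverse : ∀ x → x ≢ 0# → ∃ λ y → x * y ≡ 1#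
    _≟_ : DecidableEquality Carrier
    size : ℕ
    enum : Fin size ↔ Carrier

-- The coefficient field (the paper's ℂ): a field of characteristic 0.

natToField : {C : Set} → Op₂ C → C → C → ℕ → C
natToField _+_ 0# 1# zero = 0#
natToField _+_ 0# 1# (suc n) = 1# + natToField _+_ 0# 1# n

record Char0Field : Set₁ where
  infixl 6 _+_
  infixl 7 _*_
  infix 8 -_
  infix 9 _⁻¹
  field
    Carrier : Set
    _+_ _*_ : Op₂ Carrier
    -_ : Op₁ Carrier
    0# 1# : Carrier
    isCommutativeRing : IsCommutativeRing _≡_ _+_ _*_ -_ 0# 1#
    0≢1 : 0# ≢ 1#
    _⁻¹ : Op₁ Carrier
    ⁻¹-inverse : ∀ x → x ≢ 0# → x * (x ⁻¹) ≡ 1#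

    char0 : ∀ n → natToField _+_ 0# 1# (suc n) ≢ 0#

  fromℕ : ℕ → Carrier
  fromℕ = natToField _+_ 0# 1#

-- All the notions of the paper, relative to F = F_q, K (= ℂ) and a list
-- `chars` of K-valued functions on F meant to be the character group.

module Theory (F : FiniteField) (K : Char0Field)
              (chars : List (FiniteField.Carrier F → Char0Field.Carrier K)) where

  open FiniteField F using (_≟_; size; enum)
    renaming (Carrier to 𝔽; _+_ to _+F_; _*_ to _*F_; 0# to 0F; 1# to 1F)
  open Char0Field K renaming (Carrier to 𝕂)

  q : ℕ
  q = size

  elems : List 𝔽
  elems = map (Inverse.to enum) (allFin q)

  infixl 6 _-_
  infixr 8 _^_

  _-_ : 𝕂 → 𝕂 → 𝕂
  x - y = x + (- y)

  _^_ : 𝕂 → ℕ → 𝕂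
  x ^ zero = 1#
  x ^ suc n = x * (x ^ n)

  sumL : List 𝕂 → 𝕂
  sumL = foldr _+_ 0#

  sumOver : {A : Set} → List A → (A → 𝕂) → 𝕂
  sumOver xs f = sumL (map f xs)

  sumFin : ∀ {k} → (Fin k → 𝕂) → 𝕂
  sumFin {k} f = sumOver (allFin k) f

  prodFin : ∀ {k} → (Fin k → 𝕂) → 𝕂
  prodFin {k} f = foldr _*_ 1# (map f (allFin k))

  countℕ : {A : Set} → List A → (A → Bool) → ℕ
  countℕ xs p = sumℕ (map (λ x → if p x then 1 else 0) xs)

  qinv : 𝕂
  qinv = fromℕ q ⁻¹

  -- Multiplicative characters (extended by χ(0) = 0)

  IsCharacter : (𝔽 → 𝕂) → Set
  IsCharacter χ = (χ 0F ≡ 0#) × (χ 1F ≡ 1#) × (∀ a b → χ (a *F b) ≡ χ a * χ b)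

  IsCharacterGroup : Set
  IsCharacterGroup =
    All IsCharacter chars ×
    AllPairs (λ ψ χ → ∃ λ a → ψ a ≢ χ a) chars ×
    (∀ χ → IsCharacter χ → Any (λ ψ → ∀ a → ψ a ≡ χ a) chars) ×
    (length chars ≡ q ∸ 1)

  χ₀ : 𝔽 → 𝕂
  χ₀ a with a ≟ 0F
  ... | yes _ = 0#
  ... | no  _ = 1#

  -- complex conjugate of a character: χ̄(a) = χ(a)⁻¹ for a ≠ 0, χ̄(0) = 0
  conj : (𝔽 → 𝕂) → 𝔽 → 𝕂
  conj χ a with a ≟ 0F
  ... | yes _ = 0#
  ... | no  _ = χ a ⁻¹

  Subset : ℕ → Set
  Subset r = Vec Bool r

  allSubsets : ∀ r → List (Subset r)
  allSubsets zero = [ [] ]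
  allSubsets (suc r) =
    map (true ∷_) (allSubsets r) L.++ map (false ∷_) (allSubsets r)

  subsetsOf : ∀ {r} → Subset r → List (Subset r)
  subsetsOf [] = [ [] ]
  subsetsOf (true ∷ S) =
    map (true ∷_) (subsetsOf S) L.++ map (false ∷_) (subsetsOf S)
  subsetsOf (false ∷ S) = map (false ∷_) (subsetsOf S)

  card : ∀ {r} → Subset r → ℕ
  card [] = 0
  card (true ∷ S) = suc (card S)
  card (false ∷ S) = card S

  prodS : ∀ {r} → Subset r → (Fin r → 𝕂) → 𝕂
  prodS S g = prodFin (λ k → if lookup S k then g k else 1#)

  -- all χ_S ∈ (F_q^*)^^{|S|}, stored as r-vectors (entries outside S are
  -- the unused placeholder χ₀)
  charTuples : ∀ {r} → Subset r → List (Vec (𝔽 → 𝕂) r)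
  charTuples [] = [ [] ]
  charTuples (true ∷ S) = concatMap (λ χ → map (χ ∷_) (charTuples S)) chars
  charTuples (false ∷ S) = map (χ₀ ∷_) (charTuples S)

  -- all a_S ∈ F_q^{|S|}, stored as r-vectors with 0 outside S
  fieldTuples : ∀ {r} → Subset r → List (Vec 𝔽 r)
  fieldTuples [] = [ [] ]
  fieldTuples (true ∷ S) = concatMap (λ x → map (x ∷_) (fieldTuples S)) elems
  fieldTuples (false ∷ S) = map (0F ∷_) (fieldTuples S)

  sumVecF : ∀ {r} → Vec 𝔽 r → 𝔽
  sumVecF = V.foldr _ _+F_ 0F

  f^ : ∀ {r} → 𝔽 → Vec 𝔽 r → 𝕂
  f^ a v with sumVecF v ≟ a
  ... | yes _ = 1#
  ... | no  _ = 0#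

  restrict : ∀ {r} → Subset r → Vec 𝔽 r → Vec 𝔽 r
  restrict T b = tabulate (λ k → if lookup T k then lookup b k else 0F)

  negOnePow : ℕ → 𝕂
  negOnePow zero = 1#
  negOnePow (suc n) = - negOnePow n

  fS : ∀ {r} → 𝔽 → Subset r → Vec 𝔽 r → 𝕂
  fS a S b = sumOver (subsetsOf S)
    (λ T → negOnePow (card S ∸ card T) * f^ a (restrict T b))

  hat : ∀ {r} → (S : Subset r) → (Vec 𝔽 r → 𝕂) → Vec (𝔽 → 𝕂) r → 𝕂
  hat S g χs = ((fromℕ (q ∸ 1) ^ card S) ⁻¹) *
    sumOver (fieldTuples S)
      (λ b → g b * prodS S (λ k → conj (lookup χs k) (lookup b k)))

  Mat : ℕ → ℕ → Set
  Mat a b = Fin a → Fin b → 𝔽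

  _⊗_ : ∀ {m r n} → Mat m r → Mat r n → Mat m n
  _⊗_ {r = r} X Y i j = foldr _+F_ 0F (map (λ k → X i k *F Y k j) (allFin r))

  ct : ∀ {m n} → (𝔽 → Bool) → Mat m n → ℕ
  ct {m} {n} A N =
    sumℕ (map (λ i → countℕ (allFin n) (λ j → A (N i j))) (allFin m))

  vecsOver : {A : Set} → List A → (k : ℕ) → List (Vec A k)
  vecsOver xs zero = [ [] ]
  vecsOver xs (suc k) = concatMap (λ x → map (x ∷_) (vecsOver xs k)) xs

  allMats : ∀ a b → List (Mat a b)
  allMats a b = map (λ rows i j → lookup (lookup rows i) j)
                    (vecsOver (vecsOver elems b) a)

  𝔼 : ∀ {a b} → (Mat a b → 𝕂) → 𝕂
  𝔼 {a} {b} g = ((fromℕ q ^ (a ℕ.* b)) ⁻¹) * sumOver (allMats a b) g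

  Xvar : ∀ {m r} → Subset r → Vec (𝔽 → 𝕂) r → Mat m r → 𝕂
  Xvar S χs X = sumFin (λ i → prodS S (λ k → lookup χs k (X i k)))

  Yvar : ∀ {r n} → Subset r → Vec (𝔽 → 𝕂) r → Mat r n → 𝕂
  Yvar S χs Y = sumFin (λ j → prodS S (λ k → lookup χs k (Y k j)))

  Zvar : ∀ {m r} → Mat m r → 𝕂
  Zvar X = sumFin (λ i → prodFin (λ k → 1# - χ₀ (X i k)))

  Wvar : ∀ {r n} → Mat r n → 𝕂
  Wvar Y = sumFin (λ j → prodFin (λ k → 1# - χ₀ (Y k j)))

  γ : 𝔽 → 𝕂
  γ a with a ≟ 0F
  ... | yes _ = qinv - 1#
  ... | no  _ = qinv

  sumA : (𝔽 → Bool) → (𝔽 → 𝕂) → 𝕂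
  sumA A g = sumOver elems (λ a → if A a then g a else 0#)

  γA : (𝔽 → Bool) → 𝕂
  γA A = sumA A γ

  μA : (𝔽 → Bool) → (r m n : ℕ) → 𝕂
  μA A r m n =
    ((fromℕ (countℕ elems A) * qinv) - (γA A * ((fromℕ q ^ r) ⁻¹)))
      * fromℕ m * fromℕ n

{-# OPTIONS --safe #-}
-- Entry (i, j) of XY is the dot product of row i of X and column j of Y,
-- so ct_A(XY) = Σ_{i,j} 𝟙_A(x_i ⊛ y_j), where u ⊛ v is the entrywise
-- product and 𝟙_A(u) = [u_1 + ⋯ + u_r ∈ A]. Möbius inversion over S ⊆ [r]
-- followed by Fourier inversion with multiplicative characters on the
-- coordinates in S writes 𝟙_A(u) = Σ_{S,χ} coeff(S, χ) ∏_{k∈S} χ_k(u_k).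
-- Characters are multiplicative, so ∏ χ_k(x_k y_k) factors and the double
-- sum over i, j becomes Σ coeff · X_{S,χ} Y_{S,χ}. Centring X and Y at
-- their means leaves three correction terms, each a character expansion
-- averaged over a uniform vector x; counting the solutions of x · v = a
-- evaluates such an average to |A| q⁻¹ - γ_A [v = 0], and collecting the
-- terms gives μ_A and the corrections in Z and W.
--
-- Orthogonality of characters is derived from the hypothesis on the list
-- alone: multiplying by a character permutes the list, so the character
-- sums Σ_χ χ(t) satisfy s² = (q - 1) s, and a count shows that they
-- vanish for t ≠ 1.
module Submission where

open import Defs
open import Data.Nat using (ℕ; _<_; _≤_)
open import Data.Bool using (Bool)
open import Data.List using (List)
open import Relation.Binary.PropositionalEquality using (_≡_)

import Data.Integer.Properties as ℤP
import Data.List.Membership.Propositional.Properties as MP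
import Data.List.Properties as LP
import Data.List.Relation.Unary.All.Properties as AllP
import Data.List.Relation.Unary.AllPairs.Properties as APP
import Data.List.Relation.Unary.Any.Properties as AnyP
import Data.List.Relation.Unary.Unique.Propositional.Properties as UP
import Data.Nat.Properties as ℕP
import Data.Vec.Properties as VP
open import Algebra.Bundles using (CommutativeRing)
open import Algebra.Core using (Op₁; Op₂)
open import Algebra.Solver.Ring.AlmostCommutativeRing
  using (AlmostCommutativeRing; fromCommutativeRing; _-Raw-AlmostCommutative⟶_)
open import Algebra.Structures using (IsCommutativeRing)
open import Data.Bool using (true; false; if_then_else_)
open import Data.Empty using (⊥; ⊥-elim)
open import Data.Fin as Fin using (Fin)
open import Data.Integer as ℤ using (ℤ; -[1+_]; sign; ∣_∣)
open import Data.List as L using ([]; _∷_; map; concatMap; foldr; allFin; length; _++_)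
open import Data.List.Relation.Unary.All as All using (All; []; _∷_)
open import Data.List.Relation.Unary.AllPairs as AP using (AllPairs; []; _∷_)
open import Data.List.Relation.Unary.Any as Any using (Any; here; there; _─_)
open import Data.Maybe using (Maybe; just; nothing)
open import Data.Nat as ℕ using (zero; suc; z≤n; s≤s)
open import Data.Nat.ListAction using () renaming (sum to sumℕ)
open import Data.Product using (∃; _×_; _,_; proj₁; proj₂)
open import Data.Sign as Sign using (Sign)
open import Data.Sum using (_⊎_; inj₁; inj₂)
open import Data.Vec as V using (Vec; []; _∷_; lookup; tabulate)
open import Function using (_∘_)
open import Function.Bundles using (Inverse)
open import Relation.Binary.Definitions using (DecidableEquality)
open import Relation.Binary.PropositionalEquality
open import Relation.Nullary using (yes; no; Dec)

module RingSolver {R : Set} (_⊕_ _⊛_ : Op₂ R) (⊝_ : Op₁ R) (0# 1# : R)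
                  (isCommutativeRing : IsCommutativeRing _≡_ _⊕_ _⊛_ ⊝_ 0# 1#) where
  infixl 6 _+_
  infixl 7 _*_
  infix 8 -_
  _+_ _*_ : Op₂ R
  _+_ = _⊕_
  _*_ = _⊛_
  -_ : Op₁ R
  -_ = ⊝_
  open IsCommutativeRing isCommutativeRing public
    using (+-assoc; +-comm; *-assoc; *-comm; +-identityˡ; +-identityʳ; *-identityˡ; *-identityʳ;
           distribˡ; distribʳ; -‿inverseˡ; -‿inverseʳ; zeroˡ; zeroʳ)

  private
    commutativeRing : CommutativeRing _ _
    commutativeRing = record { isCommutativeRing = isCommutativeRing }

  open import Algebra.Properties.Ring (CommutativeRing.ring commutativeRing) public
    using (-‿involutive; -0#≈0#; -‿distribˡ-*; -‿+-comm)
  open ≡-Reasoning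

  private
    fromℕ : ℕ → R
    fromℕ = natToField _⊕_ 0# 1#

  fromℕ-+ : ∀ m n → fromℕ (m ℕ.+ n) ≡ fromℕ m + fromℕ n
  fromℕ-+ zero n = sym (+-identityˡ _)
  fromℕ-+ (suc m) n = trans (cong (1# +_) (fromℕ-+ m n)) (sym (+-assoc _ _ _))

  fromℕ-* : ∀ m n → fromℕ (m ℕ.* n) ≡ fromℕ m * fromℕ n
  fromℕ-* zero n = sym (zeroˡ _)
  fromℕ-* (suc m) n = begin
    fromℕ (n ℕ.+ m ℕ.* n)           ≡⟨ fromℕ-+ n (m ℕ.* n) ⟩
    fromℕ n + fromℕ (m ℕ.* n)       ≡⟨ cong₂ _+_ (sym (*-identityˡ _)) (fromℕ-* m n) ⟩
    1# * fromℕ n + fromℕ m * fromℕ n ≡⟨ sym (distribʳ _ _ _) ⟩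
    (1# + fromℕ m) * fromℕ n        ∎

  private
    ⟦_⟧ : ℤ → R
    ⟦ ℤ.+ n ⟧ = fromℕ n
    ⟦ -[1+ n ] ⟧ = - fromℕ (suc n)

    1+x-[1+y]≡x-y : ∀ x y → (1# + x) + - (1# + y) ≡ x + - y
    1+x-[1+y]≡x-y x y = begin
      (1# + x) + - (1# + y)   ≡⟨ cong ((1# + x) +_) (sym (-‿+-comm 1# y)) ⟩
      (1# + x) + (- 1# + - y) ≡⟨ cong (_+ (- 1# + - y)) (+-comm 1# x) ⟩
      (x + 1#) + (- 1# + - y) ≡⟨ +-assoc x 1# _ ⟩
      x + (1# + (- 1# + - y)) ≡⟨ cong (x +_) (sym (+-assoc 1# (- 1#) (- y))) ⟩
      x + ((1# + - 1#) + - y) ≡⟨ cong (λ z → x + (z + - y)) (-‿inverseʳ 1#) ⟩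
      x + (0# + - y)          ≡⟨ cong (x +_) (+-identityˡ _) ⟩
      x + - y                 ∎

    ⊖-homo : ∀ m n → ⟦ m ℤ.⊖ n ⟧ ≡ fromℕ m + - fromℕ n
    ⊖-homo m zero = trans (sym (+-identityʳ _)) (cong (fromℕ m +_) (sym -0#≈0#))
    ⊖-homo zero (suc n) = sym (+-identityˡ _)
    ⊖-homo (suc m) (suc n) = begin
      ⟦ suc m ℤ.⊖ suc n ⟧      ≡⟨ cong ⟦_⟧ (ℤP.[1+m]⊖[1+n]≡m⊖n m n) ⟩
      ⟦ m ℤ.⊖ n ⟧              ≡⟨ ⊖-homo m n ⟩
      fromℕ m + - fromℕ n      ≡⟨ sym (1+x-[1+y]≡x-y _ _) ⟩
      fromℕ (suc m) + - fromℕ (suc n) ∎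

    -‿homo : ∀ i → ⟦ ℤ.- i ⟧ ≡ - ⟦ i ⟧
    -‿homo -[1+ n ] = sym (-‿involutive _)
    -‿homo (ℤ.+ zero) = sym -0#≈0#
    -‿homo (ℤ.+ suc n) = refl

    +-homo : ∀ i j → ⟦ i ℤ.+ j ⟧ ≡ ⟦ i ⟧ + ⟦ j ⟧
    +-homo -[1+ m ] -[1+ n ] = begin
      - (1# + (1# + fromℕ (m ℕ.+ n)))       ≡⟨ cong (λ z → - (1# + (1# + z))) (fromℕ-+ m n) ⟩
      - (1# + (1# + (fromℕ m + fromℕ n)))   ≡⟨ cong -_ (shuffle (fromℕ m) (fromℕ n)) ⟩
      - ((1# + fromℕ m) + (1# + fromℕ n))   ≡⟨ sym (-‿+-comm _ _) ⟩
      - (1# + fromℕ m) + - (1# + fromℕ n)   ∎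
      where
      shuffle : ∀ a b → 1# + (1# + (a + b)) ≡ (1# + a) + (1# + b)
      shuffle a b = begin
        1# + (1# + (a + b)) ≡⟨ cong (1# +_) (sym (+-assoc 1# a b)) ⟩
        1# + ((1# + a) + b) ≡⟨ cong (λ z → 1# + (z + b)) (+-comm 1# a) ⟩
        1# + ((a + 1#) + b) ≡⟨ cong (1# +_) (+-assoc a 1# b) ⟩
        1# + (a + (1# + b)) ≡⟨ sym (+-assoc 1# a _) ⟩
        (1# + a) + (1# + b) ∎
    +-homo -[1+ m ] (ℤ.+ n) = trans (⊖-homo n (suc m)) (+-comm _ _)
    +-homo (ℤ.+ m) -[1+ n ] = ⊖-homo m (suc n)
    +-homo (ℤ.+ m) (ℤ.+ n) = fromℕ-+ m n

    ⟦_⟧ₛ : Sign → R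
    ⟦ Sign.+ ⟧ₛ = 1#
    ⟦ Sign.- ⟧ₛ = - 1#

    ◃-homo : ∀ s n → ⟦ s ℤ.◃ n ⟧ ≡ ⟦ s ⟧ₛ * fromℕ n
    ◃-homo Sign.- zero = sym (zeroʳ _)
    ◃-homo Sign.+ zero = sym (zeroʳ _)
    ◃-homo Sign.+ (suc n) = sym (*-identityˡ _)
    ◃-homo Sign.- (suc n) = trans (cong -_ (sym (*-identityˡ _))) (-‿distribˡ-* 1# _)

    sign-*-homo : ∀ s t → ⟦ s Sign.* t ⟧ₛ ≡ ⟦ s ⟧ₛ * ⟦ t ⟧ₛ
    sign-*-homo Sign.+ t = sym (*-identityˡ _)
    sign-*-homo Sign.- Sign.+ = sym (*-identityʳ _)
    sign-*-homo Sign.- Sign.- = begin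
      1#             ≡⟨ sym (-‿involutive 1#) ⟩
      - - 1#         ≡⟨ cong -_ (sym (*-identityˡ (- 1#))) ⟩
      - (1# * - 1#)  ≡⟨ -‿distribˡ-* 1# (- 1#) ⟩
      - 1# * - 1#    ∎

    interchange : ∀ a b c d → (a * b) * (c * d) ≡ (a * c) * (b * d)
    interchange a b c d = begin
      (a * b) * (c * d) ≡⟨ *-assoc a b _ ⟩
      a * (b * (c * d)) ≡⟨ cong (a *_) (sym (*-assoc b c d)) ⟩
      a * ((b * c) * d) ≡⟨ cong (λ z → a * (z * d)) (*-comm b c) ⟩
      a * ((c * b) * d) ≡⟨ cong (a *_) (*-assoc c b d) ⟩
      a * (c * (b * d)) ≡⟨ sym (*-assoc a c _) ⟩
      (a * c) * (b * d) ∎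

    *-homo : ∀ i j → ⟦ i ℤ.* j ⟧ ≡ ⟦ i ⟧ * ⟦ j ⟧
    *-homo i j = begin
      ⟦ i ℤ.* j ⟧                                     ≡⟨ ◃-homo (sign i Sign.* sign j) (∣ i ∣ ℕ.* ∣ j ∣) ⟩
      ⟦ sign i Sign.* sign j ⟧ₛ * fromℕ (∣ i ∣ ℕ.* ∣ j ∣)
        ≡⟨ cong₂ _*_ (sign-*-homo (sign i) (sign j)) (fromℕ-* ∣ i ∣ ∣ j ∣) ⟩
      (⟦ sign i ⟧ₛ * ⟦ sign j ⟧ₛ) * (fromℕ ∣ i ∣ * fromℕ ∣ j ∣) ≡⟨ interchange _ _ _ _ ⟩
      (⟦ sign i ⟧ₛ * fromℕ ∣ i ∣) * (⟦ sign j ⟧ₛ * fromℕ ∣ j ∣) ≡⟨ sym (cong₂ _*_ (sign-abs i) (sign-abs j)) ⟩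
      ⟦ i ⟧ * ⟦ j ⟧                                   ∎
      where
      sign-abs : ∀ i → ⟦ i ⟧ ≡ ⟦ sign i ⟧ₛ * fromℕ ∣ i ∣
      sign-abs i = trans (cong ⟦_⟧ (sym (ℤP.◃-inverse i))) (◃-homo (sign i) ∣ i ∣)

    -- The same map with ⟦ 1 ⟧ = 1# on the nose, so that solver
    -- constants match the literals 1# of the goals definitionally.
    ⟦_⟧′ : ℤ → R
    ⟦ ℤ.+ suc zero ⟧′ = 1#
    ⟦ i ⟧′ = ⟦ i ⟧

    ⟦⟧′≗⟦⟧ : ∀ i → ⟦ i ⟧′ ≡ ⟦ i ⟧
    ⟦⟧′≗⟦⟧ (ℤ.+ zero) = refl
    ⟦⟧′≗⟦⟧ (ℤ.+ suc zero) = sym (+-identityʳ 1#)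
    ⟦⟧′≗⟦⟧ (ℤ.+ suc (suc n)) = refl
    ⟦⟧′≗⟦⟧ -[1+ n ] = refl

    almostCommutativeRing : AlmostCommutativeRing _ _
    almostCommutativeRing = fromCommutativeRing commutativeRing

    homomorphism : ℤ.+-*-rawRing -Raw-AlmostCommutative⟶ almostCommutativeRing
    homomorphism = record
      { ⟦_⟧ = ⟦_⟧′
      ; +-homo = λ i j → transport₂ _+_ (+-homo i j) (⟦⟧′≗⟦⟧ (i ℤ.+ j)) (⟦⟧′≗⟦⟧ i) (⟦⟧′≗⟦⟧ j)
      ; *-homo = λ i j → transport₂ _*_ (*-homo i j) (⟦⟧′≗⟦⟧ (i ℤ.* j)) (⟦⟧′≗⟦⟧ i) (⟦⟧′≗⟦⟧ j)
      ; -‿homo = λ i → trans (⟦⟧′≗⟦⟧ (ℤ.- i)) (trans (-‿homo i) (sym (cong -_ (⟦⟧′≗⟦⟧ i))))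
      ; 0-homo = refl
      ; 1-homo = refl
      }
      where
      transport₂ : ∀ (_∙_ : Op₂ R) {a b c a′ b′ c′} →
        a ≡ b ∙ c → a′ ≡ a → b′ ≡ b → c′ ≡ c → a′ ≡ b′ ∙ c′
      transport₂ _∙_ e ea eb ec = trans ea (trans e (sym (cong₂ _∙_ eb ec)))

    ⟦⟧′-equal? : ∀ i j → Maybe (⟦ i ⟧′ ≡ ⟦ j ⟧′)
    ⟦⟧′-equal? i j with i ℤ.≟ j
    ... | yes refl = just refl
    ... | no _ = nothing

  open import Algebra.Solver.Ring ℤ.+-*-rawRing almostCommutativeRing homomorphism ⟦⟧′-equal? public

map-allFin-suc : ∀ {A : Set} {k} (f : Fin (suc k) → A) →
  map f (allFin (suc k)) ≡ f Fin.zero ∷ map (f ∘ Fin.suc) (allFin k)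
map-allFin-suc f = cong (f Fin.zero ∷_)
  (trans (LP.map-tabulate Fin.suc f) (sym (LP.map-tabulate (λ x → x) (f ∘ Fin.suc))))

module Sums (F : FiniteField) (K : Char0Field)
            (chars : List (FiniteField.Carrier F → Char0Field.Carrier K)) where
  open Char0Field K public
  open RingSolver _+_ _*_ -_ 0# 1# isCommutativeRing public hiding (_+_; _*_; -_)
  open Theory F K chars public
  open ≡-Reasoning

  sum-map : ∀ {A B : Set} (g : A → B) (xs : List A) (f : B → Carrier) →
    sumOver (map g xs) f ≡ sumOver xs (f ∘ g)
  sum-map g [] f = refl
  sum-map g (x ∷ xs) f = cong (f (g x) +_) (sum-map g xs f)

  sum-++ : ∀ {A : Set} (xs ys : List A) (f : A → Carrier) →
    sumOver (xs ++ ys) f ≡ sumOver xs f + sumOver ys f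
  sum-++ [] ys f = sym (+-identityˡ _)
  sum-++ (x ∷ xs) ys f = trans (cong (f x +_) (sum-++ xs ys f)) (sym (+-assoc _ _ _))

  sum-concatMap : ∀ {A B : Set} (h : A → List B) (xs : List A) (f : B → Carrier) →
    sumOver (concatMap h xs) f ≡ sumOver xs (λ x → sumOver (h x) f)
  sum-concatMap h [] f = refl
  sum-concatMap h (x ∷ xs) f =
    trans (sum-++ (h x) (concatMap h xs) f) (cong (sumOver (h x) f +_) (sum-concatMap h xs f))

  sum-cong : ∀ {A : Set} (xs : List A) {f g : A → Carrier} → (∀ x → f x ≡ g x) →
    sumOver xs f ≡ sumOver xs g
  sum-cong [] e = refl
  sum-cong (x ∷ xs) e = cong₂ _+_ (e x) (sum-cong xs e)

  sum-cong-All : ∀ {A : Set} {xs : List A} {f g : A → Carrier} → All (λ x → f x ≡ g x) xs →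
    sumOver xs f ≡ sumOver xs g
  sum-cong-All [] = refl
  sum-cong-All (e ∷ es) = cong₂ _+_ e (sum-cong-All es)

  sum-+ : ∀ {A : Set} (xs : List A) (f g : A → Carrier) →
    sumOver xs (λ x → f x + g x) ≡ sumOver xs f + sumOver xs g
  sum-+ [] f g = sym (+-identityˡ _)
  sum-+ (x ∷ xs) f g = trans (cong ((f x + g x) +_) (sum-+ xs f g))
    (solve 4 (λ a b c d → (a :+ b) :+ (c :+ d) := (a :+ c) :+ (b :+ d)) refl (f x) (g x) _ _)

  *-distribˡ-sum : ∀ {A : Set} (c : Carrier) (xs : List A) (f : A → Carrier) →
    c * sumOver xs f ≡ sumOver xs (λ x → c * f x)
  *-distribˡ-sum c [] f = zeroʳ c
  *-distribˡ-sum c (x ∷ xs) f = trans (distribˡ c _ _) (cong (c * f x +_) (*-distribˡ-sum c xs f))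

  *-distribʳ-sum : ∀ {A : Set} (c : Carrier) (xs : List A) (f : A → Carrier) →
    sumOver xs f * c ≡ sumOver xs (λ x → f x * c)
  *-distribʳ-sum c xs f =
    trans (*-comm _ c) (trans (*-distribˡ-sum c xs f) (sum-cong xs (λ x → *-comm c (f x))))

  sum-zero : ∀ {A : Set} (xs : List A) → sumOver xs (λ _ → 0#) ≡ 0#
  sum-zero [] = refl
  sum-zero (x ∷ xs) = trans (+-identityˡ _) (sum-zero xs)

  sum-zero-All : ∀ {A : Set} {xs : List A} {f : A → Carrier} → All (λ x → f x ≡ 0#) xs →
    sumOver xs f ≡ 0#
  sum-zero-All {xs = xs} es = trans (sum-cong-All es) (sum-zero xs)

  sum-neg : ∀ {A : Set} (xs : List A) (f : A → Carrier) → sumOver xs (λ x → - f x) ≡ - sumOver xs f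
  sum-neg [] f = sym -0#≈0#
  sum-neg (x ∷ xs) f = trans (cong (- f x +_) (sum-neg xs f)) (-‿+-comm _ _)

  sum-- : ∀ {A : Set} (xs : List A) (f g : A → Carrier) →
    sumOver xs (λ x → f x - g x) ≡ sumOver xs f - sumOver xs g
  sum-- xs f g = trans (sum-+ xs f (λ x → - g x)) (cong (sumOver xs f +_) (sum-neg xs g))

  sum-comm : ∀ {A B : Set} (xs : List A) (ys : List B) (f : A → B → Carrier) →
    sumOver xs (λ x → sumOver ys (f x)) ≡ sumOver ys (λ y → sumOver xs (λ x → f x y))
  sum-comm [] ys f = sym (sum-zero ys)
  sum-comm (x ∷ xs) ys f = trans (cong (sumOver ys (f x) +_) (sum-comm xs ys f))
    (sym (sum-+ ys (f x) (λ y → sumOver xs (λ x′ → f x′ y))))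

  sum-const : ∀ {A : Set} (xs : List A) (c : Carrier) → sumOver xs (λ _ → c) ≡ fromℕ (length xs) * c
  sum-const [] c = sym (zeroˡ c)
  sum-const (x ∷ xs) c = trans (cong (c +_) (sum-const xs c))
    (trans (cong (_+ fromℕ (length xs) * c) (sym (*-identityˡ c))) (sym (distribʳ c 1# _)))

  sumFin-cong : ∀ {k} {f g : Fin k → Carrier} → (∀ i → f i ≡ g i) → sumFin f ≡ sumFin g
  sumFin-cong {k} = sum-cong (allFin k)

  sumFin-const : ∀ n c → sumFin {n} (λ _ → c) ≡ fromℕ n * c
  sumFin-const n c = trans (sum-const (allFin n) c) (cong (λ t → fromℕ t * c) (LP.length-tabulate {n = n} (λ x → x)))

  prodFin-suc : ∀ {k} (f : Fin (suc k) → Carrier) → prodFin f ≡ f Fin.zero * prodFin (f ∘ Fin.suc)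
  prodFin-suc f = cong (foldr _*_ 1#) (map-allFin-suc f)

  prodFin-cong : ∀ {k} {f g : Fin k → Carrier} → (∀ i → f i ≡ g i) → prodFin f ≡ prodFin g
  prodFin-cong {zero} e = refl
  prodFin-cong {suc k} {f} {g} e = begin
    prodFin f                               ≡⟨ prodFin-suc f ⟩
    f Fin.zero * prodFin (f ∘ Fin.suc)      ≡⟨ cong₂ _*_ (e Fin.zero) (prodFin-cong (e ∘ Fin.suc)) ⟩
    g Fin.zero * prodFin (g ∘ Fin.suc)      ≡⟨ sym (prodFin-suc g) ⟩
    prodFin g                               ∎

  prodFin-* : ∀ {k} (f g : Fin k → Carrier) → prodFin (λ i → f i * g i) ≡ prodFin f * prodFin g
  prodFin-* {zero} f g = sym (*-identityˡ 1#)
  prodFin-* {suc k} f g = begin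
    prodFin (λ i → f i * g i)
      ≡⟨ prodFin-suc (λ i → f i * g i) ⟩
    (f₀ * g₀) * prodFin (λ i → f (Fin.suc i) * g (Fin.suc i))
      ≡⟨ cong ((f₀ * g₀) *_) (prodFin-* (f ∘ Fin.suc) (g ∘ Fin.suc)) ⟩
    (f₀ * g₀) * (prodFin (f ∘ Fin.suc) * prodFin (g ∘ Fin.suc))
      ≡⟨ solve 4 (λ a b c d → (a :* b) :* (c :* d) := (a :* c) :* (b :* d)) refl _ _ _ _ ⟩
    (f₀ * prodFin (f ∘ Fin.suc)) * (g₀ * prodFin (g ∘ Fin.suc))
      ≡⟨ sym (cong₂ _*_ (prodFin-suc f) (prodFin-suc g)) ⟩
    prodFin f * prodFin g ∎
    where
    f₀ g₀ : Carrier
    f₀ = f Fin.zero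
    g₀ = g Fin.zero

  ^-+ : ∀ x a b → x ^ (a ℕ.+ b) ≡ x ^ a * x ^ b
  ^-+ x zero b = sym (*-identityˡ _)
  ^-+ x (suc a) b = trans (cong (x *_) (^-+ x a b)) (sym (*-assoc _ _ _))

  ^-* : ∀ x a b → x ^ (a ℕ.* b) ≡ (x ^ b) ^ a
  ^-* x zero b = refl
  ^-* x (suc a) b = trans (^-+ x b (a ℕ.* b)) (cong (x ^ b *_) (^-* x a b))

  ^-distrib-* : ∀ a b n → (a * b) ^ n ≡ a ^ n * b ^ n
  ^-distrib-* a b zero = sym (*-identityˡ 1#)
  ^-distrib-* a b (suc n) = trans (cong ((a * b) *_) (^-distrib-* a b n))
    (solve 4 (λ a b x y → (a :* b) :* (x :* y) := (a :* x) :* (b :* y)) refl a b _ _)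

  *-cancelˡ : ∀ {x a b} → x ≢ 0# → x * a ≡ x * b → a ≡ b
  *-cancelˡ {x} {a} {b} x≢0 e = begin
    a                   ≡⟨ sym (*-identityˡ a) ⟩
    1# * a              ≡⟨ cong (_* a) (sym x⁻¹x≡1) ⟩
    (x ⁻¹ * x) * a      ≡⟨ *-assoc _ _ _ ⟩
    x ⁻¹ * (x * a)      ≡⟨ cong (x ⁻¹ *_) e ⟩
    x ⁻¹ * (x * b)      ≡⟨ sym (*-assoc _ _ _) ⟩
    (x ⁻¹ * x) * b      ≡⟨ cong (_* b) x⁻¹x≡1 ⟩
    1# * b              ≡⟨ *-identityˡ b ⟩
    b                   ∎
    where
    x⁻¹x≡1 : x ⁻¹ * x ≡ 1#
    x⁻¹x≡1 = trans (*-comm _ _) (⁻¹-inverse x x≢0)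

  *-nonzero : ∀ {a b} → a ≢ 0# → b ≢ 0# → a * b ≢ 0#
  *-nonzero {a} {b} a≢0 b≢0 ab≡0 = b≢0 (*-cancelˡ a≢0 (trans ab≡0 (sym (zeroʳ a))))

  ^-nonzero : ∀ {x} n → x ≢ 0# → x ^ n ≢ 0#
  ^-nonzero zero x≢0 e = 0≢1 (sym e)
  ^-nonzero (suc n) x≢0 = *-nonzero x≢0 (^-nonzero n x≢0)

  ⁻¹-unique : ∀ {x y} → x ≢ 0# → x * y ≡ 1# → x ⁻¹ ≡ y
  ⁻¹-unique x≢0 e = *-cancelˡ x≢0 (trans (⁻¹-inverse _ x≢0) (sym e))

  ⁻¹-distrib-* : ∀ {x y} → x ≢ 0# → y ≢ 0# → (x * y) ⁻¹ ≡ x ⁻¹ * y ⁻¹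
  ⁻¹-distrib-* {x} {y} x≢0 y≢0 = ⁻¹-unique (*-nonzero x≢0 y≢0) (begin
    (x * y) * (x ⁻¹ * y ⁻¹)
      ≡⟨ solve 4 (λ a b c d → (a :* b) :* (c :* d) := (a :* c) :* (b :* d)) refl x y _ _ ⟩
    (x * x ⁻¹) * (y * y ⁻¹) ≡⟨ cong₂ _*_ (⁻¹-inverse x x≢0) (⁻¹-inverse y y≢0) ⟩
    1# * 1#                 ≡⟨ *-identityˡ 1# ⟩
    1#                      ∎)

  ⁻¹-cancelˡ : ∀ {a} b → a ≢ 0# → a ⁻¹ * (a * b) ≡ b
  ⁻¹-cancelˡ {a} b a≢0 = begin
    a ⁻¹ * (a * b)  ≡⟨ sym (*-assoc _ _ _) ⟩
    (a ⁻¹ * a) * b  ≡⟨ cong (_* b) (trans (*-comm _ _) (⁻¹-inverse a a≢0)) ⟩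
    1# * b          ≡⟨ *-identityˡ b ⟩
    b               ∎

  𝟙 : {P : Set} → Dec P → Carrier
  𝟙 (yes _) = 1#
  𝟙 (no _) = 0#

  𝟙-cong : ∀ {P Q : Set} (p? : Dec P) (q? : Dec Q) → (P → Q) → (Q → P) → 𝟙 p? ≡ 𝟙 q?
  𝟙-cong (yes _) (yes _) f g = refl
  𝟙-cong (no _) (no _) f g = refl
  𝟙-cong (yes p) (no ¬q) f g = ⊥-elim (¬q (f p))
  𝟙-cong (no ¬p) (yes q) f g = ⊥-elim (¬p (g q))

  sum-𝟙≡ : {A : Set} (_≟A_ : DecidableEquality A) (xs : List A) → AllPairs _≢_ xs →
    ∀ {c} → Any (c ≡_) xs → (h : A → Carrier) → sumOver xs (λ x → 𝟙 (x ≟A c) * h x) ≡ h c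
  sum-𝟙≡ _≟A_ (x ∷ xs) (x∉xs ∷ _) (here refl) h with x ≟A x
  ... | no x≢x = ⊥-elim (x≢x refl)
  ... | yes _ = trans (cong₂ _+_ (*-identityˡ _) (sum-zero-All (All.map vanish x∉xs))) (+-identityʳ _)
    where
    vanish : ∀ {y} → x ≢ y → 𝟙 (y ≟A x) * h y ≡ 0#
    vanish {y} x≢y with y ≟A x
    ... | yes y≡x = ⊥-elim (x≢y (sym y≡x))
    ... | no _ = zeroˡ _
  sum-𝟙≡ _≟A_ (x ∷ xs) (x∉xs ∷ xs-distinct) {c} (there c∈xs) h with x ≟A c
  ... | yes refl = ⊥-elim (All.lookupWith (λ x≢y x≡y → x≢y x≡y) x∉xs c∈xs)
  ... | no _ = trans (cong₂ _+_ (zeroˡ _) (sum-𝟙≡ _≟A_ xs xs-distinct c∈xs h)) (+-identityˡ _)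

  Any-─ : ∀ {A : Set} {P Q : A → Set} {xs} (p : Any P xs) → Any Q xs → Q (Any.lookup p) ⊎ Any Q (xs ─ p)
  Any-─ (here _) (here q) = inj₁ q
  Any-─ (here _) (there q) = inj₂ q
  Any-─ (there p) (here q) = inj₂ (here q)
  Any-─ (there p) (there q) with Any-─ p q
  ... | inj₁ q′ = inj₁ q′
  ... | inj₂ q′ = inj₂ (there q′)

  sum-─ : ∀ {A : Set} {P : A → Set} {xs} (p : Any P xs) (f : A → Carrier) →
    sumOver xs f ≡ f (Any.lookup p) + sumOver (xs ─ p) f
  sum-─ (here _) f = refl
  sum-─ {xs = x ∷ _} (there p) f = trans (cong (f x +_) (sum-─ p f))
    (solve 3 (λ a b c → a :+ (b :+ c) := b :+ (a :+ c)) refl _ _ _)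

  -- xs matches injectively into ys of the same length, hence is a reordering of ys
  sum-reindex : {A : Set} (_≈_ : A → A → Set) (g : A → Carrier) → (∀ {x y} → x ≈ y → g x ≡ g y) →
    ∀ xs ys → length xs ≡ length ys →
    AllPairs (λ x x′ → ∀ {y} → x ≈ y → x′ ≈ y → ⊥) xs → All (λ x → Any (x ≈_) ys) xs →
    sumOver xs g ≡ sumOver ys g
  sum-reindex _≈_ g resp [] [] _ _ _ = refl
  sum-reindex _≈_ g resp (x ∷ xs) ys len (x-apart ∷ xs-apart) (x∈ys ∷ xs∈ys) = begin
    g x + sumOver xs g                             ≡⟨ cong₂ _+_ (resp (AnyP.lookup-result x∈ys)) rest ⟩
    g (Any.lookup x∈ys) + sumOver (ys ─ x∈ys) g    ≡⟨ sym (sum-─ x∈ys g) ⟩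
    sumOver ys g                                   ∎
    where
    rest : sumOver xs g ≡ sumOver (ys ─ x∈ys) g
    rest = sum-reindex _≈_ g resp xs (ys ─ x∈ys)
      (ℕP.suc-injective (trans len (LP.length-removeAt′ ys (Any.index x∈ys))))
      xs-apart (shrink x-apart xs∈ys)
      where
      shrink : ∀ {zs} → All (λ z → ∀ {y} → x ≈ y → z ≈ y → ⊥) zs →
        All (λ z → Any (z ≈_) ys) zs → All (λ z → Any (z ≈_) (ys ─ x∈ys)) zs
      shrink [] [] = []
      shrink (z-apart ∷ zs-apart) (z∈ys ∷ zs∈ys) with Any-─ x∈ys z∈ys
      ... | inj₁ z≈y = ⊥-elim (z-apart (AnyP.lookup-result x∈ys) z≈y)
      ... | inj₂ z∈ys′ = z∈ys′ ∷ shrink zs-apart zs∈ys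

  -- Equality in K is undecidable, so we cannot split on w ∈ {0, c}.
  -- Instead the inverse is blended from the inverses for both cases:
  -- u = (w/c) u₁ + (1 - w/c) u₂, where u₁ inverts the sum with w counted
  -- as c and u₂ the sum with w dropped.
  quasiIdempotents-sum-invertible : (c : Carrier) → c ≢ 0# → ∀ n (ws : List Carrier) →
    All (λ w → w * w ≡ c * w) ws → ∃ λ u → (fromℕ (suc n) * c + sumL ws) * u ≡ 1#
  quasiIdempotents-sum-invertible c c≢0 n [] [] = (fromℕ (suc n) * c + 0#) ⁻¹ , ⁻¹-inverse _ nonzero
    where
    nonzero : fromℕ (suc n) * c + 0# ≢ 0#
    nonzero e = *-nonzero (char0 n) c≢0 (trans (sym (+-identityʳ _)) e)
  quasiIdempotents-sum-invertible c c≢0 n (w ∷ ws) (w²≡cw ∷ ws-quasi) = u , proof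
    where
    N R c⁻¹ u₁ u₂ u : Carrier
    N = fromℕ (suc n)
    R = sumL ws
    c⁻¹ = c ⁻¹
    u₁ = proj₁ (quasiIdempotents-sum-invertible c c≢0 (suc n) ws ws-quasi)
    u₂ = proj₁ (quasiIdempotents-sum-invertible c c≢0 n ws ws-quasi)
    u = (w * c⁻¹) * u₁ + (1# - w * c⁻¹) * u₂
    ≡⇒-≡0 : ∀ {a b} → a ≡ b → a - b ≡ 0#
    ≡⇒-≡0 {a} e = trans (cong (λ t → a - t) (sym e)) (-‿inverseʳ a)
    d₁ : ((1# + N) * c + R) * u₁ - 1# ≡ 0#
    d₁ = ≡⇒-≡0 (proj₂ (quasiIdempotents-sum-invertible c c≢0 (suc n) ws ws-quasi))
    d₂ : (N * c + R) * u₂ - 1# ≡ 0#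
    d₂ = ≡⇒-≡0 (proj₂ (quasiIdempotents-sum-invertible c c≢0 n ws ws-quasi))
    d₃ : w * w - c * w ≡ 0#
    d₃ = ≡⇒-≡0 w²≡cw
    d₄ : 1# - c * c⁻¹ ≡ 0#
    d₄ = trans (cong (λ t → 1# - t) (⁻¹-inverse c c≢0)) (≡⇒-≡0 refl)
    proof : (N * c + (w + R)) * u ≡ 1#
    proof = begin
      (N * c + (w + R)) * u
        ≡⟨ solve 7 (λ N c w R u₁ u₂ c⁻¹ →
             (N :* c :+ (w :+ R)) :* ((w :* c⁻¹) :* u₁ :+ (con (ℤ.+ 1) :- w :* c⁻¹) :* u₂)
             := con (ℤ.+ 1) :+ (c⁻¹ :* u₁ :- u₂ :* c⁻¹) :* (w :* w :- c :* w)
                :+ u₂ :* w :* (con (ℤ.+ 1) :- c :* c⁻¹)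
                :+ w :* c⁻¹ :* (((con (ℤ.+ 1) :+ N) :* c :+ R) :* u₁ :- con (ℤ.+ 1))
                :+ (con (ℤ.+ 1) :- w :* c⁻¹) :* ((N :* c :+ R) :* u₂ :- con (ℤ.+ 1)))
             refl N c w R u₁ u₂ c⁻¹ ⟩
      1# + (c⁻¹ * u₁ - u₂ * c⁻¹) * (w * w - c * w) + u₂ * w * (1# - c * c⁻¹)
         + w * c⁻¹ * (((1# + N) * c + R) * u₁ - 1#) + (1# - w * c⁻¹) * ((N * c + R) * u₂ - 1#)
        ≡⟨ cong₂ (λ e₃ e₄ → 1# + (c⁻¹ * u₁ - u₂ * c⁻¹) * e₃ + u₂ * w * e₄
                            + w * c⁻¹ * (((1# + N) * c + R) * u₁ - 1#) + (1# - w * c⁻¹) * ((N * c + R) * u₂ - 1#))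
             d₃ d₄ ⟩
      1# + (c⁻¹ * u₁ - u₂ * c⁻¹) * 0# + u₂ * w * 0#
         + w * c⁻¹ * (((1# + N) * c + R) * u₁ - 1#) + (1# - w * c⁻¹) * ((N * c + R) * u₂ - 1#)
        ≡⟨ cong₂ (λ e₁ e₂ → 1# + (c⁻¹ * u₁ - u₂ * c⁻¹) * 0# + u₂ * w * 0# + w * c⁻¹ * e₁ + (1# - w * c⁻¹) * e₂)
             d₁ d₂ ⟩
      1# + (c⁻¹ * u₁ - u₂ * c⁻¹) * 0# + u₂ * w * 0# + w * c⁻¹ * 0# + (1# - w * c⁻¹) * 0#
        ≡⟨ solve 4 (λ a b c d → con (ℤ.+ 1) :+ a :* con (ℤ.+ 0) :+ b :* con (ℤ.+ 0) :+ c :* con (ℤ.+ 0)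
                                 :+ d :* con (ℤ.+ 0) := con (ℤ.+ 1))
             refl _ _ _ _ ⟩
      1# ∎

module CountingIdentity (F : FiniteField) (K : Char0Field)
                        (chars : List (FiniteField.Carrier F → Char0Field.Carrier K))
                        (isCharacterGroup : Theory.IsCharacterGroup F K chars) where
  open Sums F K chars public
  open FiniteField F public using (_≟_; enum; inverse)
    renaming (Carrier to 𝔽; _+_ to _+F_; _*_ to _*F_; -_ to -F_; 0# to 0F; 1# to 1F; 0≢1 to 0F≢1F)
  module 𝔽 = IsCommutativeRing (FiniteField.isCommutativeRing F)
  private
    module 𝔽Solver = RingSolver _+F_ _*F_ -F_ 0F 1F (FiniteField.isCommutativeRing F)
  open ≡-Reasoning

  chars-characters : All IsCharacter chars
  chars-characters = proj₁ isCharacterGroup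

  Apart : (𝔽 → Carrier) → (𝔽 → Carrier) → Set
  Apart ψ χ = ∃ λ a → ψ a ≢ χ a

  chars-apart : AllPairs Apart chars
  chars-apart = proj₁ (proj₂ isCharacterGroup)

  chars-complete : ∀ χ → IsCharacter χ → Any (λ ψ → ∀ a → ψ a ≡ χ a) chars
  chars-complete = proj₁ (proj₂ (proj₂ isCharacterGroup))

  length-chars : length chars ≡ q ℕ.∸ 1
  length-chars = proj₂ (proj₂ (proj₂ isCharacterGroup))

  _⁻¹F : (x : 𝔽) → {x ≢ 0F} → 𝔽
  (x ⁻¹F) {x≢0} = proj₁ (inverse x x≢0)

  ⁻¹F-inverse : ∀ x (x≢0 : x ≢ 0F) → x *F (x ⁻¹F) {x≢0} ≡ 1F
  ⁻¹F-inverse x x≢0 = proj₂ (inverse x x≢0)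

  F-cancelˡ : ∀ {c a b} → c ≢ 0F → c *F a ≡ c *F b → a ≡ b
  F-cancelˡ {c} {a} {b} c≢0 e = begin
    a                ≡⟨ sym (𝔽.*-identityˡ a) ⟩
    1F *F a          ≡⟨ cong (_*F a) (sym c⁻¹c≡1) ⟩
    (c⁻¹ *F c) *F a  ≡⟨ 𝔽.*-assoc _ _ _ ⟩
    c⁻¹ *F (c *F a)  ≡⟨ cong (c⁻¹ *F_) e ⟩
    c⁻¹ *F (c *F b)  ≡⟨ sym (𝔽.*-assoc _ _ _) ⟩
    (c⁻¹ *F c) *F b  ≡⟨ cong (_*F b) c⁻¹c≡1 ⟩
    1F *F b          ≡⟨ 𝔽.*-identityˡ b ⟩
    b                ∎
    where
    c⁻¹ : 𝔽
    c⁻¹ = (c ⁻¹F) {c≢0}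
    c⁻¹c≡1 : c⁻¹ *F c ≡ 1F
    c⁻¹c≡1 = trans (𝔽.*-comm _ _) (⁻¹F-inverse c c≢0)

  F-*-nonzero : ∀ {a b} → a ≢ 0F → b ≢ 0F → a *F b ≢ 0F
  F-*-nonzero {a} {b} a≢0 b≢0 ab≡0 = b≢0 (F-cancelˡ a≢0 (trans ab≡0 (sym (𝔽.zeroʳ a))))

  private
    to-injective : ∀ {i j} → Inverse.to enum i ≡ Inverse.to enum j → i ≡ j
    to-injective {i} {j} e = begin
      i                                        ≡⟨ sym (Inverse.strictlyInverseʳ enum i) ⟩
      Inverse.from enum (Inverse.to enum i)    ≡⟨ cong (Inverse.from enum) e ⟩
      Inverse.from enum (Inverse.to enum j)    ≡⟨ Inverse.strictlyInverseʳ enum j ⟩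
      j                                        ∎

  elems-distinct : AllPairs _≢_ elems
  elems-distinct = UP.map⁺ to-injective (UP.allFin⁺ q)

  elems-complete : ∀ x → Any (x ≡_) elems
  elems-complete x = Any.map (trans (sym (Inverse.strictlyInverseˡ enum x)))
    (MP.∈-map⁺ (Inverse.to enum) (MP.∈-allFin (Inverse.from enum x)))

  length-elems : length elems ≡ q
  length-elems = trans (LP.length-map _ (allFin q)) (LP.length-tabulate (λ x → x))

  Q : Carrier
  Q = fromℕ q

  sum-elems-const : ∀ c → sumOver elems (λ _ → c) ≡ Q * c
  sum-elems-const c = trans (sum-const elems c) (cong (λ n → fromℕ n * c) length-elems)

  sum-elems-𝟙 : ∀ c → sumOver elems (λ x → 𝟙 (x ≟ c)) ≡ 1#
  sum-elems-𝟙 c = trans (sum-cong elems (λ x → sym (*-identityʳ _)))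
    (sum-𝟙≡ _≟_ elems elems-distinct (elems-complete c) (λ _ → 1#))

  q≡2+ : ∃ λ k → q ≡ suc (suc k)
  q≡2+ = two-distinct (Inverse.from enum 0F) (Inverse.from enum 1F)
           (λ e → 0F≢1F (begin
             0F                                      ≡⟨ sym (Inverse.strictlyInverseˡ enum 0F) ⟩
             Inverse.to enum (Inverse.from enum 0F)  ≡⟨ cong (Inverse.to enum) e ⟩
             Inverse.to enum (Inverse.from enum 1F)  ≡⟨ Inverse.strictlyInverseˡ enum 1F ⟩
             1F                                      ∎))
    where
    two-distinct : ∀ {n} (i j : Fin n) → i ≢ j → ∃ λ k → n ≡ suc (suc k)
    two-distinct {suc zero} Fin.zero Fin.zero i≢j = ⊥-elim (i≢j refl)
    two-distinct {suc (suc k)} _ _ _ = k , refl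

  q-1 : Carrier
  q-1 = fromℕ (q ℕ.∸ 1)

  Q≡1+q-1 : Q ≡ 1# + q-1
  Q≡1+q-1 = cong (λ n → fromℕ n) (trans (proj₂ q≡2+) (cong suc (sym (cong (ℕ._∸ 1) (proj₂ q≡2+)))))

  q-1≢0 : q-1 ≢ 0#
  q-1≢0 e = char0 (proj₁ q≡2+) (trans (cong (λ n → fromℕ (n ℕ.∸ 1)) (sym (proj₂ q≡2+))) e)

  Q≢0 : Q ≢ 0#
  Q≢0 e = char0 (suc (proj₁ q≡2+)) (trans (cong fromℕ (sym (proj₂ q≡2+))) e)

  Q*qinv≡1 : Q * qinv ≡ 1#
  Q*qinv≡1 = ⁻¹-inverse Q Q≢0


  module Character {χ : 𝔽 → Carrier} (isχ : IsCharacter χ) where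
    χ-0 : χ 0F ≡ 0#
    χ-0 = proj₁ isχ

    χ-1 : χ 1F ≡ 1#
    χ-1 = proj₁ (proj₂ isχ)

    χ-* : ∀ a b → χ (a *F b) ≡ χ a * χ b
    χ-* = proj₂ (proj₂ isχ)

    χ-⁻¹F : ∀ a (a≢0 : a ≢ 0F) → χ a * χ ((a ⁻¹F) {a≢0}) ≡ 1#
    χ-⁻¹F a a≢0 = trans (sym (χ-* a _)) (trans (cong χ (⁻¹F-inverse a a≢0)) χ-1)

    χ-nonzero : ∀ {a} → a ≢ 0F → χ a ≢ 0#
    χ-nonzero {a} a≢0 χa≡0 = 0≢1 (begin
      0#                                  ≡⟨ sym (zeroˡ _) ⟩
      0# * χ ((a ⁻¹F) {a≢0})              ≡⟨ cong (_* χ _) (sym χa≡0) ⟩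
      χ a * χ ((a ⁻¹F) {a≢0})             ≡⟨ χ-⁻¹F a a≢0 ⟩
      1#                                  ∎)

    conj-0 : conj χ 0F ≡ 0#
    conj-0 with 0F ≟ 0F
    ... | yes _ = refl
    ... | no 0≢0 = ⊥-elim (0≢0 refl)

    conj-nonzero : ∀ {b} (b≢0 : b ≢ 0F) → conj χ b ≡ χ ((b ⁻¹F) {b≢0})
    conj-nonzero {b} b≢0 with b ≟ 0F
    ... | yes b≡0 = ⊥-elim (b≢0 b≡0)
    ... | no _ = ⁻¹-unique (χ-nonzero b≢0) (χ-⁻¹F b b≢0)

    conj-* : ∀ {b} (b≢0 : b ≢ 0F) c → conj χ b * χ c ≡ χ (c *F (b ⁻¹F) {b≢0})
    conj-* b≢0 c = trans (cong (_* χ c) (conj-nonzero b≢0)) (trans (*-comm _ _) (sym (χ-* c _)))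

  open Character public

  χ₀-0 : ∀ {a} → a ≡ 0F → χ₀ a ≡ 0#
  χ₀-0 {a} a≡0 with a ≟ 0F
  ... | yes _ = refl
  ... | no a≢0 = ⊥-elim (a≢0 a≡0)

  χ₀-nonzero : ∀ {a} → a ≢ 0F → χ₀ a ≡ 1#
  χ₀-nonzero {a} a≢0 with a ≟ 0F
  ... | yes a≡0 = ⊥-elim (a≢0 a≡0)
  ... | no _ = refl

  χ₀≡1-𝟙 : ∀ b → χ₀ b ≡ 1# - 𝟙 (b ≟ 0F)
  χ₀≡1-𝟙 b with b ≟ 0F
  ... | yes _ = sym (-‿inverseʳ 1#)
  ... | no _ = trans (sym (+-identityʳ 1#)) (cong (1# +_) (sym -0#≈0#))

  χ₀-character : IsCharacter χ₀
  χ₀-character = χ₀-0 refl , χ₀-nonzero (λ 1≡0 → 0F≢1F (sym 1≡0)) , χ₀-*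
    where
    χ₀-* : ∀ a b → χ₀ (a *F b) ≡ χ₀ a * χ₀ b
    χ₀-* a b with a ≟ 0F | b ≟ 0F
    ... | yes a≡0 | _ = trans (χ₀-0 (trans (cong (_*F b) a≡0) (𝔽.zeroˡ b))) (sym (zeroˡ _))
    ... | no _ | yes b≡0 = trans (χ₀-0 (trans (cong (a *F_) b≡0) (𝔽.zeroʳ a))) (sym (zeroʳ _))
    ... | no a≢0 | no b≢0 = trans (χ₀-nonzero (F-*-nonzero a≢0 b≢0)) (sym (*-identityˡ 1#))

  sum-χ₀ : sumOver elems χ₀ ≡ q-1
  sum-χ₀ = begin
    sumOver elems χ₀                                          ≡⟨ sum-cong elems χ₀≡1-𝟙 ⟩
    sumOver elems (λ b → 1# - 𝟙 (b ≟ 0F))                     ≡⟨ sum-- elems _ _ ⟩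
    sumOver elems (λ _ → 1#) - sumOver elems (λ b → 𝟙 (b ≟ 0F)) ≡⟨ cong₂ _-_ (sum-elems-const 1#) (sum-elems-𝟙 0F) ⟩
    Q * 1# - 1#                                               ≡⟨ cong (λ t → t * 1# - 1#) Q≡1+q-1 ⟩
    (1# + q-1) * 1# - 1#
      ≡⟨ solve 1 (λ c → (con (ℤ.+ 1) :+ c) :* con (ℤ.+ 1) :- con (ℤ.+ 1) := c) refl q-1 ⟩
    q-1                                                       ∎

  sum-character-vanishes : ∀ {φ} → IsCharacter φ → ∀ {c} → c ≢ 0F → φ c ≢ 1# → sumOver elems φ ≡ 0#
  sum-character-vanishes {φ} isφ {c} c≢0 φc≢1 = *-cancelˡ φc-1≢0 (begin
    (φ c - 1#) * Σφ  ≡⟨ solve 2 (λ a s → (a :- con (ℤ.+ 1)) :* s := a :* s :- s) refl (φ c) Σφ ⟩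
    φ c * Σφ - Σφ    ≡⟨ cong (_- Σφ) invariant ⟩
    Σφ - Σφ          ≡⟨ -‿inverseʳ Σφ ⟩
    0#               ≡⟨ sym (zeroʳ _) ⟩
    (φ c - 1#) * 0#  ∎)
    where
    Σφ : Carrier
    Σφ = sumOver elems φ
    φc-1≢0 : φ c - 1# ≢ 0#
    φc-1≢0 e = φc≢1 (begin
      φ c               ≡⟨ solve 1 (λ a → a := (a :- con (ℤ.+ 1)) :+ con (ℤ.+ 1)) refl (φ c) ⟩
      (φ c - 1#) + 1#   ≡⟨ cong (_+ 1#) e ⟩
      0# + 1#           ≡⟨ +-identityˡ _ ⟩
      1#                ∎)
    permuted : sumOver (map (c *F_) elems) φ ≡ Σφ
    permuted = sum-reindex _≡_ φ (cong φ) (map (c *F_) elems) elems (LP.length-map _ elems)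
      (AP.map (λ x≢x′ {_} e e′ → x≢x′ (trans e (sym e′))) (UP.map⁺ (F-cancelˡ c≢0) elems-distinct))
      (All.tabulate (λ {x} _ → elems-complete x))
    invariant : φ c * Σφ ≡ Σφ
    invariant = begin
      φ c * Σφ                                ≡⟨ *-distribˡ-sum (φ c) elems φ ⟩
      sumOver elems (λ b → φ c * φ b)          ≡⟨ sum-cong elems (λ b → sym (χ-* isφ c b)) ⟩
      sumOver elems (λ b → φ (c *F b))         ≡⟨ sym (sum-map (c *F_) elems φ) ⟩
      sumOver (map (c *F_) elems) φ            ≡⟨ permuted ⟩
      Σφ                                       ∎

  Apart-sym : ∀ {ψ χ} → Apart ψ χ → Apart χ ψ
  Apart-sym (a , ψa≢χa) = a , (λ e → ψa≢χa (sym e))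

  AllPairs-─ : ∀ {A : Set} {R : A → A → Set} {P : A → Set} → (∀ {a b} → R a b → R b a) →
    ∀ {xs} → AllPairs R xs → (p : Any P xs) → All (R (Any.lookup p)) (xs ─ p)
  AllPairs-─ R-sym (r ∷ _) (here _) = r
  AllPairs-─ R-sym (r ∷ rs) (there p) = R-sym (All.lookupWith (λ r _ → r) r p) ∷ AllPairs-─ R-sym rs p

  -- only the trivial character has a nonzero sum over F_q
  sum-all-characters : sumOver chars (λ χ → sumOver elems χ) ≡ q-1
  sum-all-characters = begin
    sumOver chars Σ                                ≡⟨ sum-─ χ₀∈chars Σ ⟩
    Σ (Any.lookup χ₀∈chars) + sumOver (chars ─ χ₀∈chars) Σ
      ≡⟨ cong₂ _+_ (trans (sum-cong elems (AnyP.lookup-result χ₀∈chars)) sum-χ₀)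
                   (sum-zero-All (All.zipWith vanishes
                     (AllPairs-─ Apart-sym chars-apart χ₀∈chars , AllP.─⁺ χ₀∈chars chars-characters))) ⟩
    q-1 + 0#                                       ≡⟨ +-identityʳ q-1 ⟩
    q-1                                            ∎
    where
    Σ : (𝔽 → Carrier) → Carrier
    Σ χ = sumOver elems χ
    χ₀∈chars : Any (λ ψ → ∀ a → ψ a ≡ χ₀ a) chars
    χ₀∈chars = chars-complete χ₀ χ₀-character
    vanishes : ∀ {ψ} → Apart (Any.lookup χ₀∈chars) ψ × IsCharacter ψ → Σ ψ ≡ 0#
    vanishes {ψ} ((a , χ₀a≢ψa) , isψ) = sum-character-vanishes isψ a≢0 (λ ψa≡1 →
      χ₀a≢ψa (trans (AnyP.lookup-result χ₀∈chars a) (trans (χ₀-nonzero a≢0) (sym ψa≡1))))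
      where
      a≢0 : a ≢ 0F
      a≢0 refl = χ₀a≢ψa (trans (AnyP.lookup-result χ₀∈chars 0F) (trans (χ₀-0 refl) (sym (χ-0 isψ))))

  _⊙_ : (𝔽 → Carrier) → (𝔽 → Carrier) → 𝔽 → Carrier
  (χ ⊙ ψ) a = χ a * ψ a

  ⊙-character : ∀ {χ ψ} → IsCharacter χ → IsCharacter ψ → IsCharacter (χ ⊙ ψ)
  ⊙-character {χ} {ψ} isχ isψ =
    trans (cong (_* ψ 0F) (χ-0 isχ)) (zeroˡ _) ,
    trans (cong₂ _*_ (χ-1 isχ) (χ-1 isψ)) (*-identityˡ 1#) ,
    λ a b → trans (cong₂ _*_ (χ-* isχ a b) (χ-* isψ a b))
      (solve 4 (λ x y z w → (x :* y) :* (z :* w) := (x :* z) :* (y :* w)) refl _ _ _ _)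

  charSum : 𝔽 → Carrier
  charSum t = sumOver chars (λ χ → χ t)

  -- multiplication by a character permutes the character group
  charSum-shift : ∀ {χ} → IsCharacter χ → ∀ t → sumOver chars (λ ψ → χ t * ψ t) ≡ charSum t
  charSum-shift {χ} isχ t = begin
    sumOver chars (λ ψ → χ t * ψ t)         ≡⟨ sym (sum-map (χ ⊙_) chars (λ ψ → ψ t)) ⟩
    sumOver (map (χ ⊙_) chars) (λ ψ → ψ t)  ≡⟨ sum-reindex _≗_ (λ ψ → ψ t) (λ e → e t) (map (χ ⊙_) chars) chars
                                                 (LP.length-map _ chars) (APP.map⁺ (shifted-apart chars-characters chars-apart))
                                                 (AllP.map⁺ (All.map shifted-complete chars-characters)) ⟩
    charSum t                               ∎
    where
    separated : ∀ {ψ ψ′} → IsCharacter ψ → IsCharacter ψ′ → Apart ψ ψ′ →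
      ∀ {φ} → (χ ⊙ ψ) ≗ φ → (χ ⊙ ψ′) ≗ φ → ⊥
    separated isψ isψ′ (a , ψa≢ψ′a) e e′ =
      ψa≢ψ′a (*-cancelˡ (χ-nonzero isχ a≢0) (trans (e a) (sym (e′ a))))
      where
      a≢0 : a ≢ 0F
      a≢0 refl = ψa≢ψ′a (trans (χ-0 isψ) (sym (χ-0 isψ′)))
    shifted-apart : ∀ {ψs} → All IsCharacter ψs → AllPairs Apart ψs →
      AllPairs (λ ψ ψ′ → ∀ {φ} → (χ ⊙ ψ) ≗ φ → (χ ⊙ ψ′) ≗ φ → ⊥) ψs
    shifted-apart [] [] = []
    shifted-apart (isψ ∷ areψ) (apart ∷ aparts) =
      All.zipWith (λ (isψ′ , ap) {_} → separated isψ isψ′ ap) (areψ , apart) ∷ shifted-apart areψ aparts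
    shifted-complete : ∀ {ψ} → IsCharacter ψ → Any ((χ ⊙ ψ) ≗_) chars
    shifted-complete isψ = Any.map (λ e a → sym (e a)) (chars-complete _ (⊙-character isχ isψ))

  charSum-quasiIdempotent : ∀ t → charSum t * charSum t ≡ q-1 * charSum t
  charSum-quasiIdempotent t = begin
    charSum t * charSum t                    ≡⟨ *-distribˡ-sum (charSum t) chars (λ χ → χ t) ⟩
    sumOver chars (λ χ → charSum t * χ t)     ≡⟨ sum-cong-All (All.map shift chars-characters) ⟩
    sumOver chars (λ _ → charSum t)           ≡⟨ sum-const chars (charSum t) ⟩
    fromℕ (length chars) * charSum t          ≡⟨ cong (λ n → fromℕ n * charSum t) length-chars ⟩
    q-1 * charSum t                           ∎
    where
    shift : ∀ {χ} → IsCharacter χ → charSum t * χ t ≡ charSum t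
    shift {χ} isχ = trans (*-comm _ _) (trans (*-distribˡ-sum (χ t) chars (λ ψ → ψ t)) (charSum-shift isχ t))

  charSum-1 : charSum 1F ≡ q-1
  charSum-1 = begin
    charSum 1F                  ≡⟨ sum-cong-All (All.map χ-1 chars-characters) ⟩
    sumOver chars (λ _ → 1#)    ≡⟨ sum-const chars 1# ⟩
    fromℕ (length chars) * 1#   ≡⟨ *-identityʳ _ ⟩
    fromℕ (length chars)        ≡⟨ cong fromℕ length-chars ⟩
    q-1                         ∎

  sum-charSum : sumOver elems charSum ≡ q-1
  sum-charSum = trans (sum-comm elems chars (λ b χ → χ b)) sum-all-characters

  puncture : 𝔽 → (𝔽 → Carrier) → 𝔽 → Carrier
  puncture t f b with b ≟ t
  ... | yes _ = 0#
  ... | no _ = f b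

  puncture-≢ : ∀ {t b} f → b ≢ t → puncture t f b ≡ f b
  puncture-≢ {t} {b} f b≢t with b ≟ t
  ... | yes b≡t = ⊥-elim (b≢t b≡t)
  ... | no _ = refl

  sum-puncture : ∀ t f → sumOver elems f ≡ f t + sumOver elems (puncture t f)
  sum-puncture t f = begin
    sumOver elems f                                                  ≡⟨ sum-cong elems split ⟩
    sumOver elems (λ b → 𝟙 (b ≟ t) * f b + puncture t f b)           ≡⟨ sum-+ elems _ _ ⟩
    sumOver elems (λ b → 𝟙 (b ≟ t) * f b) + sumOver elems (puncture t f)
      ≡⟨ cong (_+ sumOver elems (puncture t f)) (sum-𝟙≡ _≟_ elems elems-distinct (elems-complete t) f) ⟩
    f t + sumOver elems (puncture t f)                               ∎
    where
    split : ∀ b → f b ≡ 𝟙 (b ≟ t) * f b + puncture t f b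
    split b with b ≟ t
    ... | yes _ = sym (trans (+-identityʳ _) (*-identityˡ _))
    ... | no _ = sym (trans (cong (_+ f b) (zeroˡ _)) (+-identityˡ _))

  puncture-quasiIdempotent : ∀ c t f → (∀ b → f b * f b ≡ c * f b) →
    ∀ b → puncture t f b * puncture t f b ≡ c * puncture t f b
  puncture-quasiIdempotent c t f quasi b with b ≟ t
  ... | yes _ = trans (zeroˡ _) (sym (zeroʳ _))
  ... | no _ = quasi b

  -- Each charSum b is 0 or q - 1 and they add up to q - 1 = charSum 1.
  -- As equality in K is undecidable, charSum t = 0 is concluded from the
  -- invertibility of q - 1 + Σ_{b ∉ {1, t}} charSum b instead.
  charSum-vanishes : ∀ {t} → t ≢ 1F → charSum t ≡ 0#
  charSum-vanishes {t} t≢1 = *-cancelˡ T≢0 (begin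
    T * charSum t            ≡⟨ *-comm T _ ⟩
    charSum t * T
      ≡⟨ solve 3 (λ s c w → s :* ((con (ℤ.+ 1) :+ con (ℤ.+ 0)) :* c :+ w) := c :* s :+ s :* w) refl (charSum t) q-1 Σw′ ⟩
    q-1 * charSum t + charSum t * Σw′
      ≡⟨ cong (_+ charSum t * Σw′) (sym (charSum-quasiIdempotent t)) ⟩
    charSum t * charSum t + charSum t * Σw′  ≡⟨ sym (distribˡ (charSum t) _ _) ⟩
    charSum t * (charSum t + Σw′)             ≡⟨ cong (charSum t *_) (sym Σw≡charSum+Σw′) ⟩
    charSum t * sumOver elems w               ≡⟨ cong (charSum t *_) Σw≡0 ⟩
    charSum t * 0#                            ≡⟨ zeroʳ _ ⟩
    0#                                        ≡⟨ sym (zeroʳ T) ⟩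
    T * 0#                                    ∎)
    where
    w w′ : 𝔽 → Carrier
    w = puncture 1F charSum
    w′ = puncture t w
    Σw′ T : Carrier
    Σw′ = sumOver elems w′
    Σw≡0 : sumOver elems w ≡ 0#
    Σw≡0 = begin
      sumOver elems w                  ≡⟨ solve 2 (λ c s → s := (c :+ s) :- c) refl q-1 _ ⟩
      (q-1 + sumOver elems w) - q-1    ≡⟨ cong (λ x → (x + sumOver elems w) - q-1) (sym charSum-1) ⟩
      (charSum 1F + sumOver elems w) - q-1 ≡⟨ cong (_- q-1) (sym (sum-puncture 1F charSum)) ⟩
      sumOver elems charSum - q-1      ≡⟨ cong (_- q-1) sum-charSum ⟩
      q-1 - q-1                        ≡⟨ -‿inverseʳ q-1 ⟩
      0#                               ∎
    Σw≡charSum+Σw′ : sumOver elems w ≡ charSum t + Σw′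
    Σw≡charSum+Σw′ = trans (sum-puncture t w) (cong (_+ Σw′) (puncture-≢ charSum t≢1))
    T = fromℕ 1 * q-1 + Σw′
    T-invertible : ∃ λ u → T * u ≡ 1#
    T-invertible = quasiIdempotents-sum-invertible q-1 q-1≢0 0 (map w′ elems)
      (AllP.map⁺ (All.tabulate (λ {b} _ →
        puncture-quasiIdempotent q-1 t w (puncture-quasiIdempotent q-1 1F charSum charSum-quasiIdempotent) b)))
    T≢0 : T ≢ 0#
    T≢0 T≡0 = 0≢1 (begin
      0#                      ≡⟨ sym (zeroˡ _) ⟩
      0# * proj₁ T-invertible ≡⟨ cong (_* proj₁ T-invertible) (sym T≡0) ⟩
      T * proj₁ T-invertible  ≡⟨ proj₂ T-invertible ⟩
      1#                      ∎)

  conj-orthogonality : ∀ x c → sumOver chars (λ χ → conj χ x * χ c) ≡ 𝟙 (x ≟ c) * (χ₀ c * q-1)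
  conj-orthogonality x c = by-cases (x ≟ 0F) (c ≟ 0F)
    where
    by-cases : Dec (x ≡ 0F) → Dec (c ≡ 0F) → sumOver chars (λ χ → conj χ x * χ c) ≡ 𝟙 (x ≟ c) * (χ₀ c * q-1)
    by-cases (yes refl) _ = begin
      sumOver chars (λ χ → conj χ 0F * χ c)
        ≡⟨ sum-zero-All (All.map (λ isχ → trans (cong (_* _) (conj-0 isχ)) (zeroˡ _)) chars-characters) ⟩
      0#                                    ≡⟨ sym rhs≡0 ⟩
      𝟙 (0F ≟ c) * (χ₀ c * q-1)             ∎
      where
      rhs≡0 : 𝟙 (0F ≟ c) * (χ₀ c * q-1) ≡ 0#
      rhs≡0 with 0F ≟ c
      ... | yes refl = trans (*-identityˡ _) (trans (cong (_* q-1) (χ₀-0 refl)) (zeroˡ q-1))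
      ... | no _ = zeroˡ _
    by-cases (no x≢0) (yes refl) = begin
      sumOver chars (λ χ → conj χ x * χ 0F)
        ≡⟨ sum-zero-All (All.map (λ {χ} isχ → trans (cong (conj χ x *_) (χ-0 isχ)) (zeroʳ _)) chars-characters) ⟩
      0#                                    ≡⟨ sym (zeroʳ _) ⟩
      𝟙 (x ≟ 0F) * 0#                       ≡⟨ cong (𝟙 (x ≟ 0F) *_) (sym (trans (cong (_* q-1) (χ₀-0 refl)) (zeroˡ q-1))) ⟩
      𝟙 (x ≟ 0F) * (χ₀ 0F * q-1)            ∎
    by-cases (no x≢0) (no c≢0) = begin
      sumOver chars (λ χ → conj χ x * χ c)  ≡⟨ sum-cong-All (All.map (λ isχ → conj-* isχ x≢0 c) chars-characters) ⟩
      charSum (c *F x⁻¹)                    ≡⟨ on-diagonal (x ≟ c) ⟩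
      𝟙 (x ≟ c) * (χ₀ c * q-1)              ∎
      where
      x⁻¹ : 𝔽
      x⁻¹ = (x ⁻¹F) {x≢0}
      on-diagonal : (x≟c : Dec (x ≡ c)) → charSum (c *F x⁻¹) ≡ 𝟙 x≟c * (χ₀ c * q-1)
      on-diagonal (yes refl) = begin
        charSum (x *F x⁻¹)  ≡⟨ cong charSum (⁻¹F-inverse x x≢0) ⟩
        charSum 1F          ≡⟨ charSum-1 ⟩
        q-1                 ≡⟨ solve 1 (λ c → c := con (ℤ.+ 1) :* (con (ℤ.+ 1) :* c)) refl q-1 ⟩
        1# * (1# * q-1)     ≡⟨ cong (λ v → 1# * (v * q-1)) (sym (χ₀-nonzero c≢0)) ⟩
        1# * (χ₀ x * q-1)   ∎
      on-diagonal (no x≢c) = trans (charSum-vanishes cx⁻¹≢1) (sym (zeroˡ _))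
        where
        cx⁻¹≢1 : c *F x⁻¹ ≢ 1F
        cx⁻¹≢1 e = x≢c (sym (begin
          c                   ≡⟨ sym (𝔽.*-identityʳ c) ⟩
          c *F 1F             ≡⟨ cong (c *F_) (sym (trans (𝔽.*-comm _ _) (⁻¹F-inverse x x≢0))) ⟩
          c *F (x⁻¹ *F x)     ≡⟨ sym (𝔽.*-assoc _ _ _) ⟩
          (c *F x⁻¹) *F x     ≡⟨ cong (_*F x) e ⟩
          1F *F x             ≡⟨ 𝔽.*-identityˡ x ⟩
          x                   ∎))

  prodS-true : ∀ {r} (S : Subset r) (f : Fin (suc r) → Carrier) →
    prodS (true ∷ S) f ≡ f Fin.zero * prodS S (f ∘ Fin.suc)
  prodS-true S f = prodFin-suc (λ k → if lookup (true ∷ S) k then f k else 1#)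

  prodS-false : ∀ {r} (S : Subset r) (f : Fin (suc r) → Carrier) → prodS (false ∷ S) f ≡ prodS S (f ∘ Fin.suc)
  prodS-false S f = trans (prodFin-suc (λ k → if lookup (false ∷ S) k then f k else 1#)) (*-identityˡ _)

  charProd : ∀ {r} → Subset r → Vec (𝔽 → Carrier) r → (Fin r → 𝔽) → Carrier
  charProd S χs u = prodS S (λ k → lookup χs k (u k))

  conjProd : ∀ {r} → Subset r → Vec (𝔽 → Carrier) r → Vec 𝔽 r → Carrier
  conjProd S χs b = prodS S (λ k → conj (lookup χs k) (lookup b k))

  -- hat S g = (q - 1)^{-|S|} · transform S g
  transform : ∀ {r} → Subset r → (Vec 𝔽 r → Carrier) → Vec (𝔽 → Carrier) r → Carrier
  transform S g χs = sumOver (fieldTuples S) (λ b → g b * conjProd S χs b)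

  nonzeroOn : ∀ {r} → Subset r → Vec 𝔽 r → Carrier
  nonzeroOn S c = prodS S (λ k → χ₀ (lookup c k))

  sum-charTuples-true : ∀ {r} (S : Subset r) (f : Vec (𝔽 → Carrier) (suc r) → Carrier) →
    sumOver (charTuples (true ∷ S)) f ≡ sumOver chars (λ χ → sumOver (charTuples S) (λ χs → f (χ ∷ χs)))
  sum-charTuples-true S f =
    trans (sum-concatMap _ chars f) (sum-cong chars (λ χ → sum-map (χ ∷_) (charTuples S) f))

  sum-fieldTuples-true : ∀ {r} (S : Subset r) (f : Vec 𝔽 (suc r) → Carrier) →
    sumOver (fieldTuples (true ∷ S)) f ≡ sumOver elems (λ x → sumOver (fieldTuples S) (λ b → f (x ∷ b)))
  sum-fieldTuples-true S f =
    trans (sum-concatMap _ elems f) (sum-cong elems (λ x → sum-map (x ∷_) (fieldTuples S) f))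

  transform-true : ∀ {r} (S : Subset r) g χ χs →
    transform (true ∷ S) g (χ ∷ χs) ≡ sumOver elems (λ x → conj χ x * transform S (λ b → g (x ∷ b)) χs)
  transform-true S g χ χs = begin
    transform (true ∷ S) g (χ ∷ χs)
      ≡⟨ sum-fieldTuples-true S _ ⟩
    sumOver elems (λ x → sumOver (fieldTuples S) (λ b → g (x ∷ b) * conjProd (true ∷ S) (χ ∷ χs) (x ∷ b)))
      ≡⟨ sum-cong elems (λ x → sum-cong (fieldTuples S) (λ b → trans (cong (g (x ∷ b) *_) (prodS-true S _))
           (solve 3 (λ g a h → g :* (a :* h) := a :* (g :* h)) refl (g (x ∷ b)) (conj χ x) _))) ⟩
    sumOver elems (λ x → sumOver (fieldTuples S) (λ b → conj χ x * (g (x ∷ b) * conjProd S χs b)))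
      ≡⟨ sum-cong elems (λ x → sym (*-distribˡ-sum (conj χ x) (fieldTuples S) _)) ⟩
    sumOver elems (λ x → conj χ x * transform S (λ b → g (x ∷ b)) χs) ∎

  transform-false : ∀ {r} (S : Subset r) g χs →
    transform (false ∷ S) g (χ₀ ∷ χs) ≡ transform S (λ b → g (0F ∷ b)) χs
  transform-false S g χs = trans (sum-map (0F ∷_) (fieldTuples S) _)
    (sum-cong (fieldTuples S) (λ b → cong (g (0F ∷ b) *_) (prodS-false S _)))

  -- Fourier inversion in the coordinates in S. Characters vanish at 0, so
  -- a zero coordinate in S kills the sum, and the coordinates outside S
  -- are read as 0.
  transform-inversion : ∀ {r} (S : Subset r) (g : Vec 𝔽 r → Carrier) (c : Vec 𝔽 r) →
    sumOver (charTuples S) (λ χs → transform S g χs * charProd S χs (lookup c))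
      ≡ q-1 ^ card S * (nonzeroOn S c * g (restrict S c))
  transform-inversion [] g [] =
    solve 1 (λ x → (x :* con (ℤ.+ 1) :+ con (ℤ.+ 0)) :* con (ℤ.+ 1) :+ con (ℤ.+ 0)
                   := con (ℤ.+ 1) :* (con (ℤ.+ 1) :* x)) refl (g [])
  transform-inversion (false ∷ S) g (c₀ ∷ c) = begin
    sumOver (map (χ₀ ∷_) (charTuples S)) (λ χs → transform (false ∷ S) g χs * charProd (false ∷ S) χs (lookup (c₀ ∷ c)))
      ≡⟨ sum-map _ (charTuples S) _ ⟩
    sumOver (charTuples S) (λ χs → transform (false ∷ S) g (χ₀ ∷ χs) * charProd (false ∷ S) (χ₀ ∷ χs) (lookup (c₀ ∷ c)))
      ≡⟨ sum-cong (charTuples S) (λ χs → cong₂ _*_ (transform-false S g χs) (prodS-false S _)) ⟩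
    sumOver (charTuples S) (λ χs → transform S (λ b → g (0F ∷ b)) χs * charProd S χs (lookup c))
      ≡⟨ transform-inversion S (λ b → g (0F ∷ b)) c ⟩
    q-1 ^ card S * (nonzeroOn S c * g (0F ∷ restrict S c))
      ≡⟨ cong (λ t → q-1 ^ card S * (t * g (0F ∷ restrict S c))) (sym (prodS-false S _)) ⟩
    q-1 ^ card S * (nonzeroOn (false ∷ S) (c₀ ∷ c) * g (restrict (false ∷ S) (c₀ ∷ c))) ∎
  transform-inversion {suc r} (true ∷ S) g (c₀ ∷ c) = begin
    sumOver (charTuples (true ∷ S)) (λ χs → transform (true ∷ S) g χs * charProd (true ∷ S) χs (lookup (c₀ ∷ c)))
      ≡⟨ sum-charTuples-true S _ ⟩
    sumOver chars (λ χ → sumOver (charTuples S) (λ χs →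
      transform (true ∷ S) g (χ ∷ χs) * charProd (true ∷ S) (χ ∷ χs) (lookup (c₀ ∷ c))))
      ≡⟨ sum-cong chars (λ χ → sum-cong (charTuples S) (λ χs → split χ χs)) ⟩
    sumOver chars (λ χ → sumOver (charTuples S) (λ χs → sumOver elems (λ x → (conj χ x * χ c₀) * G x χs)))
      ≡⟨ sum-cong chars (λ χ → sum-comm (charTuples S) elems _) ⟩
    sumOver chars (λ χ → sumOver elems (λ x → sumOver (charTuples S) (λ χs → (conj χ x * χ c₀) * G x χs)))
      ≡⟨ sum-comm chars elems _ ⟩
    sumOver elems (λ x → sumOver chars (λ χ → sumOver (charTuples S) (λ χs → (conj χ x * χ c₀) * G x χs)))
      ≡⟨ sum-cong elems (λ x → sum-cong chars (λ χ → sym (*-distribˡ-sum _ (charTuples S) (G x)))) ⟩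
    sumOver elems (λ x → sumOver chars (λ χ → (conj χ x * χ c₀) * sumOver (charTuples S) (G x)))
      ≡⟨ sum-cong elems (λ x → sym (*-distribʳ-sum _ chars _)) ⟩
    sumOver elems (λ x → sumOver chars (λ χ → conj χ x * χ c₀) * sumOver (charTuples S) (G x))
      ≡⟨ sum-cong elems (λ x → cong₂ _*_ (conj-orthogonality x c₀) (transform-inversion S (λ b → g (x ∷ b)) c)) ⟩
    sumOver elems (λ x → (𝟙 (x ≟ c₀) * (χ₀ c₀ * q-1)) * (q-1 ^ card S * (nonzeroOn S c * g (x ∷ restrict S c))))
      ≡⟨ sum-cong elems (λ x → *-assoc _ _ _) ⟩
    sumOver elems (λ x → 𝟙 (x ≟ c₀) * ((χ₀ c₀ * q-1) * (q-1 ^ card S * (nonzeroOn S c * g (x ∷ restrict S c)))))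
      ≡⟨ sum-𝟙≡ _≟_ elems elems-distinct (elems-complete c₀) _ ⟩
    (χ₀ c₀ * q-1) * (q-1 ^ card S * (nonzeroOn S c * g (c₀ ∷ restrict S c)))
      ≡⟨ solve 5 (λ a b d e f → (a :* b) :* (d :* (e :* f)) := (b :* d) :* ((a :* e) :* f)) refl _ _ _ _ _ ⟩
    q-1 ^ suc (card S) * ((χ₀ c₀ * nonzeroOn S c) * g (c₀ ∷ restrict S c))
      ≡⟨ cong (λ t → q-1 ^ suc (card S) * (t * g (c₀ ∷ restrict S c))) (sym (prodS-true S _)) ⟩
    q-1 ^ card (true ∷ S) * (nonzeroOn (true ∷ S) (c₀ ∷ c) * g (restrict (true ∷ S) (c₀ ∷ c))) ∎
    where
    G : 𝔽 → Vec (𝔽 → Carrier) r → Carrier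
    G x χs = transform S (λ b → g (x ∷ b)) χs * charProd S χs (lookup c)
    split : ∀ χ χs → transform (true ∷ S) g (χ ∷ χs) * charProd (true ∷ S) (χ ∷ χs) (lookup (c₀ ∷ c))
                     ≡ sumOver elems (λ x → (conj χ x * χ c₀) * G x χs)
    split χ χs = begin
      transform (true ∷ S) g (χ ∷ χs) * charProd (true ∷ S) (χ ∷ χs) (lookup (c₀ ∷ c))
        ≡⟨ cong₂ _*_ (transform-true S g χ χs) (prodS-true S _) ⟩
      sumOver elems (λ x → conj χ x * transform S (λ b → g (x ∷ b)) χs) * (χ c₀ * charProd S χs (lookup c))
        ≡⟨ *-distribʳ-sum _ elems _ ⟩
      sumOver elems (λ x → (conj χ x * transform S (λ b → g (x ∷ b)) χs) * (χ c₀ * charProd S χs (lookup c)))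
        ≡⟨ sum-cong elems (λ x → solve 4 (λ a b d e → (a :* b) :* (d :* e) := (a :* d) :* (b :* e)) refl _ _ _ _) ⟩
      sumOver elems (λ x → (conj χ x * χ c₀) * G x χs) ∎

  -- fS a S = möbius S (f^ a)
  möbius : ∀ {r} → Subset r → (Vec 𝔽 r → Carrier) → Vec 𝔽 r → Carrier
  möbius S g b = sumOver (subsetsOf S) (λ T → negOnePow (card S ℕ.∸ card T) * g (restrict T b))

  card-subsetsOf : ∀ {r} (S : Subset r) → All (λ T → card T ≤ card S) (subsetsOf S)
  card-subsetsOf [] = z≤n ∷ []
  card-subsetsOf (true ∷ S) = AllP.++⁺ (AllP.map⁺ (All.map s≤s (card-subsetsOf S)))
                                       (AllP.map⁺ (All.map ℕP.m≤n⇒m≤1+n (card-subsetsOf S)))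
  card-subsetsOf (false ∷ S) = AllP.map⁺ (card-subsetsOf S)

  möbius-true : ∀ {r} (S : Subset r) g x c →
    möbius (true ∷ S) g (x ∷ c) ≡ möbius S (λ b → g (x ∷ b)) c - möbius S (λ b → g (0F ∷ b)) c
  möbius-true {r} S g x c = begin
    möbius (true ∷ S) g (x ∷ c)
      ≡⟨ sum-++ (map (true ∷_) (subsetsOf S)) (map (false ∷_) (subsetsOf S)) term ⟩
    sumOver (map (true ∷_) (subsetsOf S)) term + sumOver (map (false ∷_) (subsetsOf S)) term
      ≡⟨ cong₂ _+_ (sum-map _ (subsetsOf S) term) (trans (sum-map _ (subsetsOf S) term)
           (trans (sum-cong-All (All.map (λ {T} → sign-flip T) (card-subsetsOf S))) (sum-neg (subsetsOf S) _))) ⟩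
    möbius S (λ b → g (x ∷ b)) c - möbius S (λ b → g (0F ∷ b)) c ∎
    where
    term : Subset (suc r) → Carrier
    term T = negOnePow (card (true ∷ S) ℕ.∸ card T) * g (restrict T (x ∷ c))
    sign-flip : ∀ T → card T ≤ card S →
      term (false ∷ T) ≡ - (negOnePow (card S ℕ.∸ card T) * g (0F ∷ restrict T c))
    sign-flip T T≤S = trans (cong (λ n → negOnePow n * g (0F ∷ restrict T c)) (ℕP.+-∸-assoc 1 T≤S))
                            (sym (-‿distribˡ-* _ _))

  möbius-false : ∀ {r} (S : Subset r) g x c → möbius (false ∷ S) g (x ∷ c) ≡ möbius S (λ b → g (0F ∷ b)) c
  möbius-false S g x c = sum-map _ (subsetsOf S) _

  sum-möbius : ∀ {r} (g : Vec 𝔽 r → Carrier) (c : Vec 𝔽 r) → sumOver (allSubsets r) (λ S → möbius S g c) ≡ g c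
  sum-möbius {zero} g [] = trans (+-identityʳ _) (trans (+-identityʳ _) (*-identityˡ _))
  sum-möbius {suc r} g (x ∷ c) = begin
    sumOver (map (true ∷_) (allSubsets r) ++ map (false ∷_) (allSubsets r)) (λ S → möbius S g (x ∷ c))
      ≡⟨ sum-++ (map (true ∷_) (allSubsets r)) _ _ ⟩
    sumOver (map (true ∷_) (allSubsets r)) (λ S → möbius S g (x ∷ c))
      + sumOver (map (false ∷_) (allSubsets r)) (λ S → möbius S g (x ∷ c))
      ≡⟨ cong₂ _+_ (trans (sum-map _ (allSubsets r) _) (sum-cong (allSubsets r) (λ S → möbius-true S g x c)))
                   (trans (sum-map _ (allSubsets r) _) (sum-cong (allSubsets r) (λ S → möbius-false S g x c))) ⟩
    sumOver (allSubsets r) (λ S → möbius S gₓ c - möbius S g₀ c) + sumOver (allSubsets r) (λ S → möbius S g₀ c)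
      ≡⟨ cong (_+ sumOver (allSubsets r) (λ S → möbius S g₀ c)) (sum-- (allSubsets r) _ _) ⟩
    (Σgₓ - Σg₀) + Σg₀
      ≡⟨ solve 2 (λ a b → (a :- b) :+ b := a) refl Σgₓ Σg₀ ⟩
    Σgₓ ≡⟨ sum-möbius gₓ c ⟩
    g (x ∷ c) ∎
    where
    gₓ g₀ : Vec 𝔽 r → Carrier
    gₓ = λ b → g (x ∷ b)
    g₀ = λ b → g (0F ∷ b)
    Σgₓ Σg₀ : Carrier
    Σgₓ = sumOver (allSubsets r) (λ S → möbius S gₓ c)
    Σg₀ = sumOver (allSubsets r) (λ S → möbius S g₀ c)

  möbius-support : ∀ {r} (S : Subset r) (g : Vec 𝔽 r → Carrier) (c : Vec 𝔽 r) →
    möbius S g c ≡ nonzeroOn S c * möbius S g (restrict S c)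
  möbius-support [] g [] = sym (*-identityˡ _)
  möbius-support {suc r} (false ∷ S) g (x ∷ c) = begin
    möbius (false ∷ S) g (x ∷ c)                   ≡⟨ möbius-false S g x c ⟩
    möbius S g₀ c                                  ≡⟨ möbius-support S g₀ c ⟩
    nonzeroOn S c * möbius S g₀ (restrict S c)
      ≡⟨ cong₂ _*_ (sym (prodS-false S _)) (sym (möbius-false S g 0F (restrict S c))) ⟩
    nonzeroOn (false ∷ S) (x ∷ c) * möbius (false ∷ S) g (0F ∷ restrict S c) ∎
    where
    g₀ : Vec 𝔽 r → Carrier
    g₀ = λ b → g (0F ∷ b)
  möbius-support {suc r} (true ∷ S) g (x ∷ c) = begin
    möbius (true ∷ S) g (x ∷ c)                           ≡⟨ möbius-true S g x c ⟩
    möbius S gₓ c - möbius S g₀ c                          ≡⟨ by-cases (x ≟ 0F) ⟩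
    (χ₀ x * nonzeroOn S c) * (möbius S gₓ c′ - möbius S g₀ c′)
      ≡⟨ cong₂ _*_ (sym (prodS-true S _)) (sym (möbius-true S g x c′)) ⟩
    nonzeroOn (true ∷ S) (x ∷ c) * möbius (true ∷ S) g (x ∷ c′) ∎
    where
    gₓ g₀ : Vec 𝔽 r → Carrier
    gₓ = λ b → g (x ∷ b)
    g₀ = λ b → g (0F ∷ b)
    c′ : Vec 𝔽 r
    c′ = restrict S c
    by-cases : Dec (x ≡ 0F) →
      möbius S gₓ c - möbius S g₀ c ≡ (χ₀ x * nonzeroOn S c) * (möbius S gₓ c′ - möbius S g₀ c′)
    by-cases (yes refl) = begin
      möbius S g₀ c - möbius S g₀ c    ≡⟨ -‿inverseʳ _ ⟩
      0#                               ≡⟨ sym (zeroˡ _) ⟩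
      0# * D                           ≡⟨ cong (_* D) (sym (zeroˡ _)) ⟩
      (0# * nonzeroOn S c) * D         ≡⟨ cong (λ t → (t * nonzeroOn S c) * D) (sym (χ₀-0 refl)) ⟩
      (χ₀ 0F * nonzeroOn S c) * D      ∎
      where
      D : Carrier
      D = möbius S g₀ c′ - möbius S g₀ c′
    by-cases (no x≢0) = begin
      möbius S gₓ c - möbius S g₀ c
        ≡⟨ cong₂ _-_ (möbius-support S gₓ c) (möbius-support S g₀ c) ⟩
      nonzeroOn S c * möbius S gₓ c′ - nonzeroOn S c * möbius S g₀ c′
        ≡⟨ solve 3 (λ n a b → n :* a :- n :* b := (con (ℤ.+ 1) :* n) :* (a :- b)) refl _ _ _ ⟩
      (1# * nonzeroOn S c) * (möbius S gₓ c′ - möbius S g₀ c′)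
        ≡⟨ cong (λ t → (t * nonzeroOn S c) * (möbius S gₓ c′ - möbius S g₀ c′)) (sym (χ₀-nonzero x≢0)) ⟩
      (χ₀ x * nonzeroOn S c) * (möbius S gₓ c′ - möbius S g₀ c′) ∎

  fourier-inversion : ∀ {r} (S : Subset r) (g : Vec 𝔽 r → Carrier) (c : Vec 𝔽 r) →
    sumOver (charTuples S) (λ χs → hat S (möbius S g) χs * charProd S χs (lookup c)) ≡ möbius S g c
  fourier-inversion S g c = begin
    sumOver (charTuples S) (λ χs → (λ⁻¹ * transform S (möbius S g) χs) * charProd S χs (lookup c))
      ≡⟨ sum-cong (charTuples S) (λ χs → *-assoc _ _ _) ⟩
    sumOver (charTuples S) (λ χs → λ⁻¹ * (transform S (möbius S g) χs * charProd S χs (lookup c)))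
      ≡⟨ sym (*-distribˡ-sum λ⁻¹ (charTuples S) _) ⟩
    λ⁻¹ * sumOver (charTuples S) (λ χs → transform S (möbius S g) χs * charProd S χs (lookup c))
      ≡⟨ cong (λ⁻¹ *_) (transform-inversion S (möbius S g) c) ⟩
    λ⁻¹ * (q-1 ^ card S * (nonzeroOn S c * möbius S g (restrict S c)))
      ≡⟨ ⁻¹-cancelˡ _ (^-nonzero (card S) q-1≢0) ⟩
    nonzeroOn S c * möbius S g (restrict S c)
      ≡⟨ sym (möbius-support S g c) ⟩
    möbius S g c ∎
    where
    λ⁻¹ : Carrier
    λ⁻¹ = (q-1 ^ card S) ⁻¹

  if-*ʳ : ∀ (b : Bool) x c → (if b then x else 0#) * c ≡ (if b then x * c else 0#)
  if-*ʳ true x c = refl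
  if-*ʳ false x c = zeroˡ c

  sum-if : ∀ {X : Set} (b : Bool) (xs : List X) (f : X → Carrier) →
    sumOver xs (λ x → if b then f x else 0#) ≡ (if b then sumOver xs f else 0#)
  sum-if true xs f = refl
  sum-if false xs f = sum-zero xs

  sumA-cong : ∀ A {f g : 𝔽 → Carrier} → (∀ a → f a ≡ g a) → sumA A f ≡ sumA A g
  sumA-cong A e = sum-cong elems (λ a → cong (if A a then_else 0#) (e a))

  *-distribʳ-sumA : ∀ A (h : 𝔽 → Carrier) c → sumA A h * c ≡ sumA A (λ a → h a * c)
  *-distribʳ-sumA A h c = trans (*-distribʳ-sum c elems _) (sum-cong elems (λ a → if-*ʳ (A a) (h a) c))

  *-distribˡ-sumA : ∀ A c (h : 𝔽 → Carrier) → c * sumA A h ≡ sumA A (λ a → c * h a)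
  *-distribˡ-sumA A c h = trans (trans (*-comm _ _) (*-distribʳ-sumA A h c)) (sumA-cong A (λ a → *-comm _ _))

  sum-sumA : ∀ {X : Set} A (xs : List X) (f : X → 𝔽 → Carrier) →
    sumOver xs (λ x → sumA A (f x)) ≡ sumA A (λ a → sumOver xs (λ x → f x a))
  sum-sumA A xs f = trans (sum-comm xs elems _) (sum-cong elems (λ a → sum-if (A a) xs (λ x → f x a)))

  sumA-- : ∀ A (f g : 𝔽 → Carrier) → sumA A (λ a → f a - g a) ≡ sumA A f - sumA A g
  sumA-- A f g = trans (sum-cong elems distrib) (sum-- elems _ _)
    where
    distrib : ∀ a → (if A a then f a - g a else 0#) ≡ (if A a then f a else 0#) - (if A a then g a else 0#)
    distrib a with A a
    ... | true = refl
    ... | false = sym (trans (cong (0# +_) -0#≈0#) (+-identityʳ 0#))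

  ΣSχ : ∀ {r} → (Subset r → Vec (𝔽 → Carrier) r → Carrier) → Carrier
  ΣSχ {r} g = sumOver (allSubsets r) (λ S → sumOver (charTuples S) (g S))

  ΣSχ-cong : ∀ {r} {g h : Subset r → Vec (𝔽 → Carrier) r → Carrier} →
    (∀ S χs → g S χs ≡ h S χs) → ΣSχ g ≡ ΣSχ h
  ΣSχ-cong {r} e = sum-cong (allSubsets r) (λ S → sum-cong (charTuples S) (e S))

  ΣSχ-cong-All : ∀ {r} {g h : Subset r → Vec (𝔽 → Carrier) r → Carrier} →
    (∀ S → All (λ χs → g S χs ≡ h S χs) (charTuples S)) → ΣSχ g ≡ ΣSχ h
  ΣSχ-cong-All {r} e = sum-cong (allSubsets r) (λ S → sum-cong-All (e S))

  ΣSχ-sum : ∀ {r} {X : Set} (xs : List X) (g : X → Subset r → Vec (𝔽 → Carrier) r → Carrier) →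
    ΣSχ (λ S χs → sumOver xs (λ x → g x S χs)) ≡ sumOver xs (λ x → ΣSχ (g x))
  ΣSχ-sum {r} xs g = trans (sum-cong (allSubsets r) (λ S → sum-comm (charTuples S) xs _)) (sum-comm (allSubsets r) xs _)

  *-distribˡ-ΣSχ : ∀ {r} c (g : Subset r → Vec (𝔽 → Carrier) r → Carrier) → c * ΣSχ g ≡ ΣSχ (λ S χs → c * g S χs)
  *-distribˡ-ΣSχ {r} c g = trans (*-distribˡ-sum c (allSubsets r) _)
    (sum-cong (allSubsets r) (λ S → *-distribˡ-sum c (charTuples S) _))

  ΣSχ-+ : ∀ {r} (g h : Subset r → Vec (𝔽 → Carrier) r → Carrier) →
    ΣSχ (λ S χs → g S χs + h S χs) ≡ ΣSχ g + ΣSχ h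
  ΣSχ-+ {r} g h = trans (sum-cong (allSubsets r) (λ S → sum-+ (charTuples S) _ _)) (sum-+ (allSubsets r) _ _)

  ΣSχ-- : ∀ {r} (g h : Subset r → Vec (𝔽 → Carrier) r → Carrier) →
    ΣSχ (λ S χs → g S χs - h S χs) ≡ ΣSχ g - ΣSχ h
  ΣSχ-- {r} g h = trans (sum-cong (allSubsets r) (λ S → sum-- (charTuples S) _ _)) (sum-- (allSubsets r) _ _)

  𝟙A : ∀ {r} → (𝔽 → Bool) → (Fin r → 𝔽) → Carrier
  𝟙A A u = sumA A (λ a → f^ a (tabulate u))

  coeff : ∀ {r} → (𝔽 → Bool) → Subset r → Vec (𝔽 → Carrier) r → Carrier
  coeff A S χs = sumA A (λ a → hat S (fS a S) χs)

  charProd-cong : ∀ {r} (S : Subset r) χs {u v : Fin r → 𝔽} → (∀ k → u k ≡ v k) → charProd S χs u ≡ charProd S χs v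
  charProd-cong S χs e = prodFin-cong (λ k → cong (λ t → if lookup S k then lookup χs k t else 1#) (e k))

  𝟙A-expansion : ∀ {r} (A : 𝔽 → Bool) (u : Fin r → 𝔽) → ΣSχ (λ S χs → coeff A S χs * charProd S χs u) ≡ 𝟙A A u
  𝟙A-expansion {r} A u = begin
    ΣSχ (λ S χs → coeff A S χs * charProd S χs u)
      ≡⟨ ΣSχ-cong (λ S χs → *-distribʳ-sumA A (λ a → hat S (fS a S) χs) (charProd S χs u)) ⟩
    ΣSχ (λ S χs → sumA A (λ a → hat S (fS a S) χs * charProd S χs u))
      ≡⟨ trans (sum-cong (allSubsets r) (λ S → sum-sumA A (charTuples S) _)) (sum-sumA A (allSubsets r) _) ⟩
    sumA A (λ a → sumOver (allSubsets r) (λ S → sumOver (charTuples S) (λ χs → hat S (fS a S) χs * charProd S χs u)))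
      ≡⟨ sumA-cong A (λ a → sum-cong (allSubsets r) (λ S → trans
           (sum-cong (charTuples S) (λ χs → cong (hat S (fS a S) χs *_) (charProd-cong S χs (λ k → sym (VP.lookup∘tabulate u k)))))
           (fourier-inversion S (f^ a) (tabulate u)))) ⟩
    sumA A (λ a → sumOver (allSubsets r) (λ S → möbius S (f^ a) (tabulate u)))
      ≡⟨ sumA-cong A (λ a → sum-möbius (f^ a) (tabulate u)) ⟩
    𝟙A A u ∎

  charTuples-characters : ∀ {r} (S : Subset r) → All (λ χs → ∀ k → IsCharacter (lookup χs k)) (charTuples S)
  charTuples-characters [] = (λ ()) ∷ []
  charTuples-characters (true ∷ S) = AllP.concat⁺ (AllP.map⁺ (All.map (λ isχ → AllP.map⁺
    (All.map (λ areχ → λ { Fin.zero → isχ ; (Fin.suc k) → areχ k }) (charTuples-characters S))) chars-characters))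
  charTuples-characters (false ∷ S) =
    AllP.map⁺ (All.map (λ areχ → λ { Fin.zero → χ₀-character ; (Fin.suc k) → areχ k }) (charTuples-characters S))

  _⊛_ : ∀ {r} → (Fin r → 𝔽) → (Fin r → 𝔽) → Fin r → 𝔽
  (u ⊛ v) k = u k *F v k

  charProd-⊛ : ∀ {r} (S : Subset r) χs → (∀ k → IsCharacter (lookup χs k)) →
    ∀ u v → charProd S χs u * charProd S χs v ≡ charProd S χs (u ⊛ v)
  charProd-⊛ S χs areχ u v = trans (sym (prodFin-* (λ k → if lookup S k then lookup χs k (u k) else 1#)
                                                     (λ k → if lookup S k then lookup χs k (v k) else 1#)))
                                     (prodFin-cong factor)
    where
    factor : ∀ k → (if lookup S k then lookup χs k (u k) else 1#) * (if lookup S k then lookup χs k (v k) else 1#)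
                   ≡ (if lookup S k then lookup χs k (u k *F v k) else 1#)
    factor k with lookup S k
    ... | true = sym (χ-* (areχ k) (u k) (v k))
    ... | false = *-identityˡ 1#

  -- The row sums defining X and Y and the expectation over a uniform
  -- vector are all weighted sums.
  WeightedSum : ℕ → Set
  WeightedSum r = Carrier × List (Fin r → 𝔽)

  ⟪_⟫ : ∀ {r} → WeightedSum r → ((Fin r → 𝔽) → Carrier) → Carrier
  ⟪ w , us ⟫ ψ = w * sumOver us ψ

  ⟪⟫-cong : ∀ {r} (L : WeightedSum r) {ψ φ} → (∀ u → ψ u ≡ φ u) → ⟪ L ⟫ ψ ≡ ⟪ L ⟫ φ
  ⟪⟫-cong (w , us) e = cong (w *_) (sum-cong us e)

  *-distribˡ-⟪⟫ : ∀ {r} (L : WeightedSum r) c ψ → c * ⟪ L ⟫ ψ ≡ ⟪ L ⟫ (λ u → c * ψ u)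
  *-distribˡ-⟪⟫ (w , us) c ψ = begin
    c * (w * sumOver us ψ)     ≡⟨ solve 3 (λ c w s → c :* (w :* s) := w :* (c :* s)) refl c w _ ⟩
    w * (c * sumOver us ψ)     ≡⟨ cong (w *_) (*-distribˡ-sum c us ψ) ⟩
    w * sumOver us (λ u → c * ψ u) ∎

  *-distribʳ-⟪⟫ : ∀ {r} (L : WeightedSum r) c ψ → ⟪ L ⟫ ψ * c ≡ ⟪ L ⟫ (λ u → ψ u * c)
  *-distribʳ-⟪⟫ L c ψ = trans (*-comm _ c) (trans (*-distribˡ-⟪⟫ L c ψ) (⟪⟫-cong L (λ u → *-comm c (ψ u))))

  ⟪⟫-- : ∀ {r} (L : WeightedSum r) ψ φ → ⟪ L ⟫ (λ u → ψ u - φ u) ≡ ⟪ L ⟫ ψ - ⟪ L ⟫ φ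
  ⟪⟫-- (w , us) ψ φ = trans (cong (w *_) (sum-- us ψ φ))
    (solve 3 (λ w a b → w :* (a :- b) := w :* a :- w :* b) refl w _ _)

  ΣSχ-⟪⟫ : ∀ {r} (L : WeightedSum r) {r′} (g : Subset r′ → Vec (𝔽 → Carrier) r′ → (Fin r → 𝔽) → Carrier) →
    ΣSχ (λ S χs → ⟪ L ⟫ (g S χs)) ≡ ⟪ L ⟫ (λ u → ΣSχ (λ S χs → g S χs u))
  ΣSχ-⟪⟫ (w , us) g = trans (sym (*-distribˡ-ΣSχ w (λ S χs → sumOver us (g S χs)))) (cong (w *_) (ΣSχ-sum us (λ u S χs → g S χs u)))

  ⟪⟫-comm : ∀ {r} (L M : WeightedSum r) (f : (Fin r → 𝔽) → (Fin r → 𝔽) → Carrier) →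
    ⟪ L ⟫ (λ u → ⟪ M ⟫ (f u)) ≡ ⟪ M ⟫ (λ v → ⟪ L ⟫ (λ u → f u v))
  ⟪⟫-comm (w , us) (w′ , vs) f = begin
    w * sumOver us (λ u → w′ * sumOver vs (f u))     ≡⟨ cong (w *_) (sym (*-distribˡ-sum w′ us _)) ⟩
    w * (w′ * sumOver us (λ u → sumOver vs (f u)))    ≡⟨ cong (λ t → w * (w′ * t)) (sum-comm us vs f) ⟩
    w * (w′ * sumOver vs (λ v → sumOver us (λ u → f u v)))
      ≡⟨ solve 3 (λ a b s → a :* (b :* s) := b :* (a :* s)) refl w w′ _ ⟩
    w′ * (w * sumOver vs (λ v → sumOver us (λ u → f u v)))
      ≡⟨ cong (w′ *_) (*-distribˡ-sum w vs _) ⟩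
    w′ * sumOver vs (λ v → w * sumOver us (λ u → f u v)) ∎

  -- charProd is multiplicative, so a product of two weighted sums of it
  -- expands into a weighted double sum of 𝟙A
  coeff-bilinear : ∀ {r} (A : 𝔽 → Bool) (L M : WeightedSum r) →
    ΣSχ (λ S χs → coeff A S χs * (⟪ L ⟫ (charProd S χs) * ⟪ M ⟫ (charProd S χs)))
      ≡ ⟪ L ⟫ (λ u → ⟪ M ⟫ (λ v → 𝟙A A (u ⊛ v)))
  coeff-bilinear {r} A L M = begin
    ΣSχ (λ S χs → coeff A S χs * (⟪ L ⟫ (charProd S χs) * ⟪ M ⟫ (charProd S χs)))
      ≡⟨ ΣSχ-cong-All (λ S → All.map (λ {χs} → product S χs) (charTuples-characters S)) ⟩
    ΣSχ (λ S χs → ⟪ L ⟫ (λ u → ⟪ M ⟫ (λ v → coeff A S χs * charProd S χs (u ⊛ v))))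
      ≡⟨ ΣSχ-⟪⟫ L (λ S χs u → ⟪ M ⟫ (λ v → coeff A S χs * charProd S χs (u ⊛ v))) ⟩
    ⟪ L ⟫ (λ u → ΣSχ (λ S χs → ⟪ M ⟫ (λ v → coeff A S χs * charProd S χs (u ⊛ v))))
      ≡⟨ ⟪⟫-cong L (λ u → trans (ΣSχ-⟪⟫ M (λ S χs v → coeff A S χs * charProd S χs (u ⊛ v))) (⟪⟫-cong M (λ v → 𝟙A-expansion A (u ⊛ v)))) ⟩
    ⟪ L ⟫ (λ u → ⟪ M ⟫ (λ v → 𝟙A A (u ⊛ v))) ∎
    where
    product : ∀ S χs → (∀ k → IsCharacter (lookup χs k)) →
      coeff A S χs * (⟪ L ⟫ (charProd S χs) * ⟪ M ⟫ (charProd S χs))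
        ≡ ⟪ L ⟫ (λ u → ⟪ M ⟫ (λ v → coeff A S χs * charProd S χs (u ⊛ v)))
    product S χs areχ = begin
      coeff A S χs * (⟪ L ⟫ ψ * ⟪ M ⟫ ψ)
        ≡⟨ cong (coeff A S χs *_) (trans (*-distribʳ-⟪⟫ L _ ψ) (⟪⟫-cong L (λ u →
             trans (*-distribˡ-⟪⟫ M (ψ u) ψ) (⟪⟫-cong M (λ v → charProd-⊛ S χs areχ u v))))) ⟩
      coeff A S χs * ⟪ L ⟫ (λ u → ⟪ M ⟫ (λ v → ψ (u ⊛ v)))
        ≡⟨ trans (*-distribˡ-⟪⟫ L _ _) (⟪⟫-cong L (λ u → *-distribˡ-⟪⟫ M _ _)) ⟩
      ⟪ L ⟫ (λ u → ⟪ M ⟫ (λ v → coeff A S χs * ψ (u ⊛ v))) ∎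
      where
      ψ : (Fin r → 𝔽) → Carrier
      ψ = charProd S χs

  x+y≡z⇒y≡z-x : ∀ {x y z} → x +F y ≡ z → y ≡ z +F (-F x)
  x+y≡z⇒y≡z-x {x} {y} e = trans (𝔽Solver.solve 2 (λ x y → y 𝔽Solver.:= (x 𝔽Solver.:+ y) 𝔽Solver.:- x) refl x y) (cong (λ t → t +F (-F x)) e)

  y≡z-x⇒x+y≡z : ∀ {x y z} → y ≡ z +F (-F x) → x +F y ≡ z
  y≡z-x⇒x+y≡z {x} {z = z} refl = 𝔽Solver.solve 2 (λ x z → x 𝔽Solver.:+ (z 𝔽Solver.:- x) 𝔽Solver.:= z) refl x z

  z-xv≡0⇒x≡z/v : ∀ {x v z} (v≢0 : v ≢ 0F) → z +F (-F (x *F v)) ≡ 0F → x ≡ z *F (v ⁻¹F) {v≢0}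
  z-xv≡0⇒x≡z/v {x} {v} {z} v≢0 e = begin
    x                       ≡⟨ sym (𝔽.*-identityʳ x) ⟩
    x *F 1F                 ≡⟨ cong (x *F_) (sym (⁻¹F-inverse v v≢0)) ⟩
    x *F (v *F v⁻¹)         ≡⟨ sym (𝔽.*-assoc x v v⁻¹) ⟩
    (x *F v) *F v⁻¹         ≡⟨ cong (_*F v⁻¹) xv≡z ⟩
    z *F v⁻¹                ∎
    where
    v⁻¹ : 𝔽
    v⁻¹ = (v ⁻¹F) {v≢0}
    xv≡z : x *F v ≡ z
    xv≡z = sym (trans (𝔽Solver.solve 2 (λ z y → z 𝔽Solver.:= (z 𝔽Solver.:- y) 𝔽Solver.:+ y) refl z (x *F v))
                      (trans (cong (_+F (x *F v)) e) (𝔽.+-identityˡ _)))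

  x≡z/v⇒z-xv≡0 : ∀ {x v z} (v≢0 : v ≢ 0F) → x ≡ z *F (v ⁻¹F) {v≢0} → z +F (-F (x *F v)) ≡ 0F
  x≡z/v⇒z-xv≡0 {v = v} {z} v≢0 refl = begin
    z +F (-F ((z *F v⁻¹) *F v))  ≡⟨ cong (λ t → z +F (-F t)) (trans (𝔽.*-assoc z v⁻¹ v)
                                      (cong (z *F_) (trans (𝔽.*-comm v⁻¹ v) (⁻¹F-inverse v v≢0)))) ⟩
    z +F (-F (z *F 1F))          ≡⟨ cong (λ t → z +F (-F t)) (𝔽.*-identityʳ z) ⟩
    z +F (-F z)                  ≡⟨ 𝔽.-‿inverseʳ z ⟩
    0F                           ∎
    where
    v⁻¹ : 𝔽
    v⁻¹ = (v ⁻¹F) {v≢0}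

  f^≡𝟙 : ∀ {r} a (v : Vec 𝔽 r) → f^ a v ≡ 𝟙 (sumVecF v ≟ a)
  f^≡𝟙 a v with sumVecF v ≟ a
  ... | yes _ = refl
  ... | no _ = refl

  f^-∷ : ∀ {r} a y (w : Vec 𝔽 r) → f^ a (y ∷ w) ≡ f^ (a +F (-F y)) w
  f^-∷ a y w = begin
    f^ a (y ∷ w)                        ≡⟨ f^≡𝟙 a (y ∷ w) ⟩
    𝟙 ((y +F sumVecF w) ≟ a)            ≡⟨ 𝟙-cong (_ ≟ a) (_ ≟ _) x+y≡z⇒y≡z-x y≡z-x⇒x+y≡z ⟩
    𝟙 (sumVecF w ≟ (a +F (-F y)))       ≡⟨ sym (f^≡𝟙 _ w) ⟩
    f^ (a +F (-F y)) w                  ∎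

  γ≡qinv-𝟙 : ∀ a → γ a ≡ qinv - 𝟙 (a ≟ 0F)
  γ≡qinv-𝟙 a with a ≟ 0F
  ... | yes _ = refl
  ... | no _ = trans (sym (+-identityʳ qinv)) (cong (qinv +_) (sym -0#≈0#))

  isZeroVec : ∀ {r} → (Fin r → 𝔽) → Carrier
  isZeroVec v = prodFin (λ k → 1# - χ₀ (v k))

  sum-vecsOver-suc : ∀ {A : Set} (xs : List A) k (f : Vec A (suc k) → Carrier) →
    sumOver (vecsOver xs (suc k)) f ≡ sumOver xs (λ x → sumOver (vecsOver xs k) (λ v → f (x ∷ v)))
  sum-vecsOver-suc xs k f = trans (sum-concatMap _ xs f) (sum-cong xs (λ x → sum-map (x ∷_) (vecsOver xs k) f))

  sum-γ-affine : ∀ a v₀ z → sumOver elems (λ x₀ → qinv - γ (a +F (-F (x₀ *F v₀))) * z)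
                             ≡ Q * (qinv - γ a * ((1# - χ₀ v₀) * z))
  sum-γ-affine a v₀ z = by-cases (v₀ ≟ 0F)
    where
    by-cases : Dec (v₀ ≡ 0F) → sumOver elems (λ x₀ → qinv - γ (a +F (-F (x₀ *F v₀))) * z)
                               ≡ Q * (qinv - γ a * ((1# - χ₀ v₀) * z))
    by-cases (yes v₀≡0) = begin
      sumOver elems (λ x₀ → qinv - γ (a +F (-F (x₀ *F v₀))) * z)
        ≡⟨ sum-cong elems (λ x₀ → cong (λ t → qinv - γ t * z) (a-x₀v₀≡a x₀)) ⟩
      sumOver elems (λ _ → qinv - γ a * z)   ≡⟨ sum-elems-const _ ⟩
      Q * (qinv - γ a * z)                   ≡⟨ cong (λ t → Q * (qinv - γ a * t)) (sym (*-identityˡ z)) ⟩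
      Q * (qinv - γ a * (1# * z))            ≡⟨ cong (λ t → Q * (qinv - γ a * (t * z))) (sym 1-0≡1) ⟩
      Q * (qinv - γ a * ((1# - 0#) * z))     ≡⟨ cong (λ t → Q * (qinv - γ a * ((1# - t) * z))) (sym (χ₀-0 v₀≡0)) ⟩
      Q * (qinv - γ a * ((1# - χ₀ v₀) * z))  ∎
      where
      a-x₀v₀≡a : ∀ x₀ → a +F (-F (x₀ *F v₀)) ≡ a
      a-x₀v₀≡a x₀ = trans (cong (λ t → a +F (-F t)) (trans (cong (x₀ *F_) v₀≡0) (𝔽.zeroʳ x₀)))
                          (trans (cong (a +F_) (𝔽Solver.-0#≈0#)) (𝔽.+-identityʳ a))
      1-0≡1 : 1# - 0# ≡ 1#
      1-0≡1 = trans (cong (1# +_) -0#≈0#) (+-identityʳ 1#)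
    by-cases (no v₀≢0) = trans lhs≡1 (sym rhs≡1)
      where
      c : 𝔽
      c = a *F (v₀ ⁻¹F) {v₀≢0}
      lhs≡1 : sumOver elems (λ x₀ → qinv - γ (a +F (-F (x₀ *F v₀))) * z) ≡ 1#
      lhs≡1 = begin
        sumOver elems (λ x₀ → qinv - γ (a +F (-F (x₀ *F v₀))) * z)
          ≡⟨ sum-cong elems (λ x₀ → cong (λ t → qinv - t * z) (trans (γ≡qinv-𝟙 _)
               (cong (λ t → qinv - t) (𝟙-cong (_ ≟ 0F) (x₀ ≟ c) (z-xv≡0⇒x≡z/v v₀≢0) (x≡z/v⇒z-xv≡0 v₀≢0))))) ⟩
        sumOver elems (λ x₀ → qinv - (qinv - 𝟙 (x₀ ≟ c)) * z)
          ≡⟨ sum-cong elems (λ x₀ → solve 3 (λ i d z → i :- (i :- d) :* z := i :* (con (ℤ.+ 1) :- z) :+ d :* z) refl qinv _ z) ⟩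
        sumOver elems (λ x₀ → qinv * (1# - z) + 𝟙 (x₀ ≟ c) * z)
          ≡⟨ sum-+ elems _ _ ⟩
        sumOver elems (λ _ → qinv * (1# - z)) + sumOver elems (λ x₀ → 𝟙 (x₀ ≟ c) * z)
          ≡⟨ cong₂ _+_ (sum-elems-const _) (sum-𝟙≡ _≟_ elems elems-distinct (elems-complete c) (λ _ → z)) ⟩
        Q * (qinv * (1# - z)) + z
          ≡⟨ cong (_+ z) (sym (*-assoc Q qinv _)) ⟩
        (Q * qinv) * (1# - z) + z
          ≡⟨ cong (λ t → t * (1# - z) + z) Q*qinv≡1 ⟩
        1# * (1# - z) + z
          ≡⟨ solve 1 (λ z → con (ℤ.+ 1) :* (con (ℤ.+ 1) :- z) :+ z := con (ℤ.+ 1)) refl z ⟩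
        1# ∎
      rhs≡1 : Q * (qinv - γ a * ((1# - χ₀ v₀) * z)) ≡ 1#
      rhs≡1 = begin
        Q * (qinv - γ a * ((1# - χ₀ v₀) * z))  ≡⟨ cong (λ t → Q * (qinv - γ a * ((1# - t) * z))) (χ₀-nonzero v₀≢0) ⟩
        Q * (qinv - γ a * ((1# - 1#) * z))     ≡⟨ solve 4 (λ Q i g z → Q :* (i :- g :* ((con (ℤ.+ 1) :- con (ℤ.+ 1)) :* z)) := Q :* i)
                                                    refl Q qinv (γ a) z ⟩
        Q * qinv                               ≡⟨ Q*qinv≡1 ⟩
        1#                                     ∎

  sum-f^-dot : ∀ r a (v : Fin r → 𝔽) →
    sumOver (vecsOver elems r) (λ x → f^ a (tabulate (λ k → lookup x k *F v k))) ≡ Q ^ r * (qinv - γ a * isZeroVec v)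
  sum-f^-dot zero a v = begin
    f^ a [] + 0#                   ≡⟨ +-identityʳ _ ⟩
    f^ a []                        ≡⟨ f^≡𝟙 a [] ⟩
    𝟙 (0F ≟ a)                     ≡⟨ 𝟙-cong (0F ≟ a) (a ≟ 0F) sym sym ⟩
    𝟙 (a ≟ 0F)                     ≡⟨ solve 2 (λ i d → d := con (ℤ.+ 1) :* (i :- (i :- d) :* con (ℤ.+ 1))) refl qinv _ ⟩
    1# * (qinv - (qinv - 𝟙 (a ≟ 0F)) * 1#) ≡⟨ cong (λ t → 1# * (qinv - t * 1#)) (sym (γ≡qinv-𝟙 a)) ⟩
    1# * (qinv - γ a * 1#)         ∎
  sum-f^-dot (suc r) a v = begin
    sumOver (vecsOver elems (suc r)) (λ x → f^ a (tabulate (λ k → lookup x k *F v k)))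
      ≡⟨ sum-vecsOver-suc elems r _ ⟩
    sumOver elems (λ x₀ → sumOver (vecsOver elems r) (λ x → f^ a ((x₀ *F v₀) ∷ tabulate (λ k → lookup x k *F v′ k))))
      ≡⟨ sum-cong elems (λ x₀ → trans (sum-cong (vecsOver elems r) (λ x → f^-∷ a (x₀ *F v₀) _)) (sum-f^-dot r _ v′)) ⟩
    sumOver elems (λ x₀ → Q ^ r * (qinv - γ (a +F (-F (x₀ *F v₀))) * isZeroVec v′))
      ≡⟨ sym (*-distribˡ-sum (Q ^ r) elems _) ⟩
    Q ^ r * sumOver elems (λ x₀ → qinv - γ (a +F (-F (x₀ *F v₀))) * isZeroVec v′)
      ≡⟨ cong (Q ^ r *_) (sum-γ-affine a v₀ (isZeroVec v′)) ⟩
    Q ^ r * (Q * (qinv - γ a * ((1# - χ₀ v₀) * isZeroVec v′)))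
      ≡⟨ solve 3 (λ R Q x → R :* (Q :* x) := Q :* R :* x) refl (Q ^ r) Q _ ⟩
    Q ^ suc r * (qinv - γ a * ((1# - χ₀ v₀) * isZeroVec v′))
      ≡⟨ cong (λ t → Q ^ suc r * (qinv - γ a * t)) (sym (prodFin-suc (λ k → 1# - χ₀ (v k)))) ⟩
    Q ^ suc r * (qinv - γ a * isZeroVec v) ∎
    where
    v₀ : 𝔽
    v₀ = v Fin.zero
    v′ : Fin r → 𝔽
    v′ = v ∘ Fin.suc

  uniform : ∀ r → WeightedSum r
  uniform r = (Q ^ r) ⁻¹ , map lookup (vecsOver elems r)

  Q^r≢0 : ∀ r → Q ^ r ≢ 0#
  Q^r≢0 r = ^-nonzero r Q≢0

  sum-vecsOver-const : ∀ {A : Set} (xs : List A) k c →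
    sumOver (vecsOver xs k) (λ _ → c) ≡ fromℕ (L.length xs) ^ k * c
  sum-vecsOver-const xs zero c = trans (+-identityʳ c) (sym (*-identityˡ c))
  sum-vecsOver-const xs (suc k) c = begin
    sumOver (vecsOver xs (suc k)) (λ _ → c)                   ≡⟨ sum-vecsOver-suc xs k _ ⟩
    sumOver xs (λ _ → sumOver (vecsOver xs k) (λ _ → c))       ≡⟨ sum-const xs _ ⟩
    ℓ * sumOver (vecsOver xs k) (λ _ → c)                      ≡⟨ cong (ℓ *_) (sum-vecsOver-const xs k c) ⟩
    ℓ * (ℓ ^ k * c)                                            ≡⟨ sym (*-assoc _ _ _) ⟩
    ℓ ^ suc k * c                                              ∎
    where
    ℓ : Carrier
    ℓ = fromℕ (L.length xs)

  sum-vecs-const : ∀ r c → sumOver (vecsOver elems r) (λ _ → c) ≡ Q ^ r * c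
  sum-vecs-const r c = trans (sum-vecsOver-const elems r c) (cong (λ n → fromℕ n ^ r * c) length-elems)

  uniform-const : ∀ r c → ⟪ uniform r ⟫ (λ _ → c) ≡ c
  uniform-const r c = trans (cong ((Q ^ r) ⁻¹ *_) (trans (sum-map lookup (vecsOver elems r) _) (sum-vecs-const r c)))
                            (⁻¹-cancelˡ c (Q^r≢0 r))

  sum-vecs-isZeroVec : ∀ r → sumOver (vecsOver elems r) (λ v → isZeroVec (lookup v)) ≡ 1#
  sum-vecs-isZeroVec zero = +-identityʳ 1#
  sum-vecs-isZeroVec (suc r) = begin
    sumOver (vecsOver elems (suc r)) (λ v → isZeroVec (lookup v))       ≡⟨ sum-vecsOver-suc elems r _ ⟩
    sumOver elems (λ x → sumOver (vecsOver elems r) (λ v → isZeroVec (lookup (x ∷ v))))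
      ≡⟨ sum-cong elems (λ x → trans (sum-cong (vecsOver elems r) (λ v → prodFin-suc (λ k → 1# - χ₀ (lookup (x ∷ v) k))))
           (trans (sym (*-distribˡ-sum _ (vecsOver elems r) _)) (trans (cong ((1# - χ₀ x) *_) (sum-vecs-isZeroVec r)) (*-identityʳ _)))) ⟩
    sumOver elems (λ x → 1# - χ₀ x)
      ≡⟨ sum-cong elems (λ x → trans (cong (λ t → 1# - t) (χ₀≡1-𝟙 x))
           (solve 1 (λ d → con (ℤ.+ 1) :- (con (ℤ.+ 1) :- d) := d) refl _)) ⟩
    sumOver elems (λ x → 𝟙 (x ≟ 0F))                                   ≡⟨ sum-elems-𝟙 0F ⟩
    1#                                                                 ∎

  uniform-isZeroVec : ∀ r → ⟪ uniform r ⟫ isZeroVec ≡ (Q ^ r) ⁻¹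
  uniform-isZeroVec r = trans (cong ((Q ^ r) ⁻¹ *_) (trans (sum-map lookup (vecsOver elems r) _) (sum-vecs-isZeroVec r)))
                              (*-identityʳ _)

  fromℕ-countℕ : ∀ {X : Set} (xs : List X) (p : X → Bool) →
    fromℕ (countℕ xs p) ≡ sumOver xs (λ x → if p x then 1# else 0#)
  fromℕ-countℕ [] p = refl
  fromℕ-countℕ (x ∷ xs) p = trans (fromℕ-+ (if p x then 1 else 0) _) (cong₂ _+_ (fromℕ-if (p x)) (fromℕ-countℕ xs p))
    where
    fromℕ-if : ∀ b → fromℕ (if b then 1 else 0) ≡ (if b then 1# else 0#)
    fromℕ-if true = +-identityʳ 1#
    fromℕ-if false = refl

  sumA-const : ∀ A c → sumA A (λ _ → c) ≡ fromℕ (countℕ elems A) * c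
  sumA-const A c = begin
    sumA A (λ _ → c)                                     ≡⟨ sumA-cong A (λ _ → sym (*-identityˡ c)) ⟩
    sumA A (λ _ → 1# * c)                                ≡⟨ sym (*-distribʳ-sumA A (λ _ → 1#) c) ⟩
    sumOver elems (λ a → if A a then 1# else 0#) * c     ≡⟨ cong (_* c) (sym (fromℕ-countℕ elems A)) ⟩
    fromℕ (countℕ elems A) * c                           ∎

  α : (𝔽 → Bool) → Carrier
  α A = fromℕ (countℕ elems A) * qinv

  uniform-𝟙A-⊛ : ∀ {r} A (v : Fin r → 𝔽) → ⟪ uniform r ⟫ (λ x → 𝟙A A (x ⊛ v)) ≡ α A - γA A * isZeroVec v
  uniform-𝟙A-⊛ {r} A v = begin
    (Q ^ r) ⁻¹ * sumOver (map lookup (vecsOver elems r)) (λ x → 𝟙A A (x ⊛ v))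
      ≡⟨ cong ((Q ^ r) ⁻¹ *_) (trans (sum-map lookup (vecsOver elems r) _)
           (trans (sum-sumA A (vecsOver elems r) _) (sumA-cong A (λ a → sum-f^-dot r a v)))) ⟩
    (Q ^ r) ⁻¹ * sumA A (λ a → Q ^ r * (qinv - γ a * isZeroVec v))
      ≡⟨ cong ((Q ^ r) ⁻¹ *_) (sym (*-distribˡ-sumA A _ _)) ⟩
    (Q ^ r) ⁻¹ * (Q ^ r * sumA A (λ a → qinv - γ a * isZeroVec v))
      ≡⟨ ⁻¹-cancelˡ _ (Q^r≢0 r) ⟩
    sumA A (λ a → qinv - γ a * isZeroVec v)
      ≡⟨ sumA-- A _ _ ⟩
    sumA A (λ _ → qinv) - sumA A (λ a → γ a * isZeroVec v)
      ≡⟨ cong₂ _-_ (sumA-const A qinv) (sym (*-distribʳ-sumA A γ (isZeroVec v))) ⟩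
    α A - γA A * isZeroVec v ∎

  uniform-𝟙A-⊛′ : ∀ {r} A (u : Fin r → 𝔽) → ⟪ uniform r ⟫ (λ y → 𝟙A A (u ⊛ y)) ≡ α A - γA A * isZeroVec u
  uniform-𝟙A-⊛′ {r} A u = trans (⟪⟫-cong (uniform r) (λ y → cong (λ w → sumA A (λ a → f^ a w)) (VP.tabulate-cong (λ k → 𝔽.*-comm (u k) (y k))))) (uniform-𝟙A-⊛ A u)

  ⁻¹-*-cancel : ∀ {a b} s → a ≢ 0# → b ≢ 0# → (a * b) ⁻¹ * (b * s) ≡ a ⁻¹ * s
  ⁻¹-*-cancel {a} {b} s a≢0 b≢0 = begin
    (a * b) ⁻¹ * (b * s)      ≡⟨ cong (_* (b * s)) (⁻¹-distrib-* a≢0 b≢0) ⟩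
    (a ⁻¹ * b ⁻¹) * (b * s)   ≡⟨ solve 4 (λ x y b s → (x :* y) :* (b :* s) := x :* (y :* (b :* s))) refl _ _ b s ⟩
    a ⁻¹ * (b ⁻¹ * (b * s))   ≡⟨ cong (a ⁻¹ *_) (⁻¹-cancelˡ s b≢0) ⟩
    a ⁻¹ * s                  ∎

  sum-vecsOver-lookup : ∀ {A : Set} (xs : List A) m (i : Fin (suc m)) (φ : A → Carrier) →
    sumOver (vecsOver xs (suc m)) (λ rows → φ (lookup rows i)) ≡ fromℕ (length xs) ^ m * sumOver xs φ
  sum-vecsOver-lookup xs m Fin.zero φ = begin
    sumOver (vecsOver xs (suc m)) (λ rows → φ (lookup rows Fin.zero))
      ≡⟨ sum-vecsOver-suc xs m _ ⟩
    sumOver xs (λ x → sumOver (vecsOver xs m) (λ _ → φ x))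
      ≡⟨ sum-cong xs (λ x → sum-vecsOver-const xs m (φ x)) ⟩
    sumOver xs (λ x → fromℕ (length xs) ^ m * φ x)
      ≡⟨ sym (*-distribˡ-sum _ xs φ) ⟩
    fromℕ (length xs) ^ m * sumOver xs φ ∎
  sum-vecsOver-lookup xs (suc m) (Fin.suc i) φ = begin
    sumOver (vecsOver xs (suc (suc m))) (λ rows → φ (lookup rows (Fin.suc i)))
      ≡⟨ sum-vecsOver-suc xs (suc m) _ ⟩
    sumOver xs (λ _ → sumOver (vecsOver xs (suc m)) (λ rows → φ (lookup rows i)))
      ≡⟨ sum-cong xs (λ _ → sum-vecsOver-lookup xs m i φ) ⟩
    sumOver xs (λ _ → fromℕ (length xs) ^ m * sumOver xs φ)
      ≡⟨ sum-const xs _ ⟩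
    fromℕ (length xs) * (fromℕ (length xs) ^ m * sumOver xs φ)
      ≡⟨ sym (*-assoc _ _ _) ⟩
    fromℕ (length xs) ^ suc m * sumOver xs φ ∎

  sum-vecsOver-column : ∀ {A : Set} (xs : List A) n r (j : Fin (suc n)) (φ : Vec A r → Carrier) →
    sumOver (vecsOver (vecsOver xs (suc n)) r) (λ rows → φ (V.map (λ row → lookup row j) rows))
      ≡ (fromℕ (length xs) ^ n) ^ r * sumOver (vecsOver xs r) φ
  sum-vecsOver-column xs n zero j φ = sym (*-identityˡ _)
  sum-vecsOver-column {A} xs n (suc r) j φ = begin
    sumOver (vecsOver W (suc r)) (λ rows → φ (V.map (λ row → lookup row j) rows))
      ≡⟨ sum-vecsOver-suc W r _ ⟩
    sumOver W (λ row → sumOver (vecsOver W r) (λ rows → φ (lookup row j ∷ V.map (λ row → lookup row j) rows)))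
      ≡⟨ sum-cong W (λ row → sum-vecsOver-column xs n r j (λ v → φ (lookup row j ∷ v))) ⟩
    sumOver W (λ row → ℓⁿ ^ r * sumOver (vecsOver xs r) (λ v → φ (lookup row j ∷ v)))
      ≡⟨ sym (*-distribˡ-sum _ W _) ⟩
    ℓⁿ ^ r * sumOver W (λ row → sumOver (vecsOver xs r) (λ v → φ (lookup row j ∷ v)))
      ≡⟨ cong (ℓⁿ ^ r *_) (sum-comm W (vecsOver xs r) _) ⟩
    ℓⁿ ^ r * sumOver (vecsOver xs r) (λ v → sumOver W (λ row → φ (lookup row j ∷ v)))
      ≡⟨ cong (ℓⁿ ^ r *_) (sum-cong (vecsOver xs r) (λ v → sum-vecsOver-lookup xs n j (λ x → φ (x ∷ v)))) ⟩
    ℓⁿ ^ r * sumOver (vecsOver xs r) (λ v → ℓⁿ * sumOver xs (λ x → φ (x ∷ v)))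
      ≡⟨ cong (ℓⁿ ^ r *_) (sym (*-distribˡ-sum _ (vecsOver xs r) _)) ⟩
    ℓⁿ ^ r * (ℓⁿ * sumOver (vecsOver xs r) (λ v → sumOver xs (λ x → φ (x ∷ v))))
      ≡⟨ solve 3 (λ a b s → a :* (b :* s) := b :* a :* s) refl _ _ _ ⟩
    ℓⁿ ^ suc r * sumOver (vecsOver xs r) (λ v → sumOver xs (λ x → φ (x ∷ v)))
      ≡⟨ cong (ℓⁿ ^ suc r *_) (trans (sum-comm (vecsOver xs r) xs _) (sym (sum-vecsOver-suc xs r φ))) ⟩
    ℓⁿ ^ suc r * sumOver (vecsOver xs (suc r)) φ ∎
    where
    W : List (Vec A (suc n))
    W = vecsOver xs (suc n)
    ℓⁿ : Carrier
    ℓⁿ = fromℕ (length xs) ^ n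

  fromℕ-length-vecs : ∀ r → fromℕ (length (vecsOver elems r)) ≡ Q ^ r
  fromℕ-length-vecs r = begin
    fromℕ (length (vecsOver elems r))        ≡⟨ sym (*-identityʳ _) ⟩
    fromℕ (length (vecsOver elems r)) * 1#   ≡⟨ sym (sum-const (vecsOver elems r) 1#) ⟩
    sumOver (vecsOver elems r) (λ _ → 1#)    ≡⟨ sum-vecs-const r 1# ⟩
    Q ^ r * 1#                               ≡⟨ *-identityʳ _ ⟩
    Q ^ r                                    ∎

  𝔼-row : ∀ {m r} (i : Fin m) (ψ : (Fin r → 𝔽) → Carrier) → 𝔼 {m} {r} (λ M → ψ (M i)) ≡ ⟪ uniform r ⟫ ψ
  𝔼-row {suc m} {r} i ψ = begin
    (Q ^ (suc m ℕ.* r)) ⁻¹ * sumOver (allMats (suc m) r) (λ M → ψ (M i))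
      ≡⟨ cong₂ (λ a b → a ⁻¹ * b) (^-* Q (suc m) r)
           (trans (sum-map _ (vecsOver W (suc m)) _) (sum-vecsOver-lookup W m i (λ row → ψ (lookup row)))) ⟩
    (Q ^ r * (Q ^ r) ^ m) ⁻¹ * (fromℕ (length W) ^ m * sumOver W (λ row → ψ (lookup row)))
      ≡⟨ cong (λ ℓ → (Q ^ r * (Q ^ r) ^ m) ⁻¹ * (ℓ ^ m * sumOver W (λ row → ψ (lookup row)))) (fromℕ-length-vecs r) ⟩
    (Q ^ r * (Q ^ r) ^ m) ⁻¹ * ((Q ^ r) ^ m * sumOver W (λ row → ψ (lookup row)))
      ≡⟨ ⁻¹-*-cancel _ (Q^r≢0 r) (^-nonzero m (Q^r≢0 r)) ⟩
    (Q ^ r) ⁻¹ * sumOver W (λ row → ψ (lookup row))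
      ≡⟨ cong ((Q ^ r) ⁻¹ *_) (sym (sum-map lookup W ψ)) ⟩
    ⟪ uniform r ⟫ ψ ∎
    where
    W : List (Vec 𝔽 r)
    W = vecsOver elems r

  𝔼-column : ∀ {r n} (j : Fin n) (ψ : (Fin r → 𝔽) → Carrier) → (∀ {u v} → (∀ k → u k ≡ v k) → ψ u ≡ ψ v) →
    𝔼 {r} {n} (λ M → ψ (λ k → M k j)) ≡ ⟪ uniform r ⟫ ψ
  𝔼-column {r} {suc n} j ψ ψ-cong = begin
    (Q ^ (r ℕ.* suc n)) ⁻¹ * sumOver (allMats r (suc n)) (λ M → ψ (λ k → M k j))
      ≡⟨ cong₂ (λ a b → a ⁻¹ * b) (trans (^-* Q r (suc n)) (^-distrib-* Q (Q ^ n) r)) (begin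
           sumOver (allMats r (suc n)) (λ M → ψ (λ k → M k j))
             ≡⟨ sum-map _ (vecsOver W r) _ ⟩
           sumOver (vecsOver W r) (λ rows → ψ (λ k → lookup (lookup rows k) j))
             ≡⟨ sum-cong (vecsOver W r) (λ rows → ψ-cong (λ k → sym (VP.lookup-map k (λ row → lookup row j) rows))) ⟩
           sumOver (vecsOver W r) (λ rows → ψ (lookup (V.map (λ row → lookup row j) rows)))
             ≡⟨ sum-vecsOver-column elems n r j (λ v → ψ (lookup v)) ⟩
           (fromℕ (length elems) ^ n) ^ r * Σψ
             ≡⟨ cong (λ ℓ → (fromℕ ℓ ^ n) ^ r * Σψ) length-elems ⟩
           (Q ^ n) ^ r * Σψ ∎) ⟩
    (Q ^ r * (Q ^ n) ^ r) ⁻¹ * ((Q ^ n) ^ r * Σψ)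
      ≡⟨ ⁻¹-*-cancel _ (Q^r≢0 r) (^-nonzero r (Q^r≢0 n)) ⟩
    (Q ^ r) ⁻¹ * Σψ
      ≡⟨ cong ((Q ^ r) ⁻¹ *_) (sym (sum-map lookup (vecsOver elems r) ψ)) ⟩
    ⟪ uniform r ⟫ ψ ∎
    where
    W : List (Vec 𝔽 (suc n))
    W = vecsOver elems (suc n)
    Σψ : Carrier
    Σψ = sumOver (vecsOver elems r) (λ v → ψ (lookup v))

  𝔼-sumFin : ∀ {a b k} (f : Fin k → Mat a b → Carrier) → 𝔼 {a} {b} (λ M → sumFin (λ i → f i M)) ≡ sumFin (λ i → 𝔼 {a} {b} (f i))
  𝔼-sumFin {a} {b} {k} f = trans (cong (_ *_) (sum-comm (allMats a b) (allFin k) (λ M i → f i M)))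
                                 (*-distribˡ-sum _ (allFin k) _)

  𝔼-rowSum : ∀ {m r} (ψ : (Fin r → 𝔽) → Carrier) →
    𝔼 {m} {r} (λ M → sumFin (λ i → ψ (M i))) ≡ fromℕ m * ⟪ uniform r ⟫ ψ
  𝔼-rowSum {m} {r} ψ = trans (𝔼-sumFin {m} {r} (λ i M → ψ (M i))) (trans (sumFin-cong {m} (λ i → 𝔼-row i ψ)) (sumFin-const m _))

  𝔼-columnSum : ∀ {r n} (ψ : (Fin r → 𝔽) → Carrier) → (∀ {u v} → (∀ k → u k ≡ v k) → ψ u ≡ ψ v) →
    𝔼 {r} {n} (λ M → sumFin (λ j → ψ (λ k → M k j))) ≡ fromℕ n * ⟪ uniform r ⟫ ψ
  𝔼-columnSum {r} {n} ψ ψ-cong =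
    trans (𝔼-sumFin {r} {n} (λ j M → ψ (λ k → M k j))) (trans (sumFin-cong {n} (λ j → 𝔼-column j ψ ψ-cong)) (sumFin-const n _))

  rows : ∀ {m r} → Mat m r → WeightedSum r
  rows {m} X = 1# , map X (allFin m)

  columns : ∀ {r n} → Mat r n → WeightedSum r
  columns {n = n} Y = 1# , map (λ j k → Y k j) (allFin n)

  ⟪rows⟫ : ∀ {m r} (X : Mat m r) ψ → ⟪ rows X ⟫ ψ ≡ sumFin (λ i → ψ (X i))
  ⟪rows⟫ {m} X ψ = trans (*-identityˡ _) (sum-map X (allFin m) ψ)

  ⟪columns⟫ : ∀ {r n} (Y : Mat r n) ψ → ⟪ columns Y ⟫ ψ ≡ sumFin (λ j → ψ (λ k → Y k j))
  ⟪columns⟫ {n = n} Y ψ = trans (*-identityˡ _) (sum-map _ (allFin n) ψ)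

  sumFin-affine : ∀ k a g (z : Fin k → Carrier) → sumFin {k} (λ i → a - g * z i) ≡ fromℕ k * a - g * sumFin z
  sumFin-affine k a g z = trans (sum-- (allFin k) _ _) (cong₂ _-_ (sumFin-const k a) (sym (*-distribˡ-sum g (allFin k) z)))

  sumVecF-tabulate : ∀ {r} (h : Fin r → 𝔽) → sumVecF (tabulate h) ≡ foldr _+F_ 0F (map h (allFin r))
  sumVecF-tabulate {zero} h = refl
  sumVecF-tabulate {suc r} h =
    trans (cong (h Fin.zero +F_) (sumVecF-tabulate (h ∘ Fin.suc))) (sym (cong (foldr _+F_ 0F) (map-allFin-suc h)))

  𝟙A≡if : ∀ {r} A (u : Fin r → 𝔽) s → sumVecF (tabulate u) ≡ s → 𝟙A A u ≡ (if A s then 1# else 0#)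
  𝟙A≡if A u s sum≡s = trans (sum-cong elems select) (sum-𝟙≡ _≟_ elems elems-distinct (elems-complete s) (λ a → if A a then 1# else 0#))
    where
    select : ∀ a → (if A a then f^ a (tabulate u) else 0#) ≡ 𝟙 (a ≟ s) * (if A a then 1# else 0#)
    select a with A a
    ... | true = trans (f^≡𝟙 a (tabulate u))
                   (trans (𝟙-cong (_ ≟ a) (a ≟ s) (λ e → trans (sym e) sum≡s) (λ e → trans sum≡s (sym e))) (sym (*-identityʳ _)))
    ... | false = sym (zeroʳ _)

  fromℕ-sumℕ : ∀ {X : Set} (xs : List X) (h : X → ℕ) → fromℕ (sumℕ (map h xs)) ≡ sumOver xs (λ x → fromℕ (h x))
  fromℕ-sumℕ [] h = refl
  fromℕ-sumℕ (x ∷ xs) h = trans (fromℕ-+ (h x) _) (cong (fromℕ (h x) +_) (fromℕ-sumℕ xs h))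

  ct≡⟪⟫ : ∀ {m r n} A (X : Mat m r) (Y : Mat r n) →
    fromℕ (ct A (X ⊗ Y)) ≡ ⟪ rows X ⟫ (λ u → ⟪ columns Y ⟫ (λ v → 𝟙A A (u ⊛ v)))
  ct≡⟪⟫ {m} {r} {n} A X Y = begin
    fromℕ (ct A (X ⊗ Y))
      ≡⟨ fromℕ-sumℕ (allFin m) _ ⟩
    sumFin (λ i → fromℕ (countℕ (allFin n) (λ j → A ((X ⊗ Y) i j))))
      ≡⟨ sumFin-cong (λ i → trans (fromℕ-countℕ (allFin n) _)
           (sumFin-cong (λ j → sym (𝟙A≡if A (λ k → X i k *F Y k j) _ (sumVecF-tabulate (λ k → X i k *F Y k j)))))) ⟩
    sumFin (λ i → sumFin (λ j → 𝟙A A (X i ⊛ (λ k → Y k j))))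
      ≡⟨ sym (trans (⟪rows⟫ X _) (sumFin-cong {m} (λ i → ⟪columns⟫ Y (λ v → 𝟙A A (X i ⊛ v))))) ⟩
    ⟪ rows X ⟫ (λ u → ⟪ columns Y ⟫ (λ v → 𝟙A A (u ⊛ v))) ∎

  mean : ∀ {r} → Subset r → Vec (𝔽 → Carrier) r → Carrier
  mean {r} S χs = ⟪ uniform r ⟫ (charProd S χs)

  𝔼-Xvar : ∀ {m r} S χs → 𝔼 {m} {r} (Xvar S χs) ≡ fromℕ m * mean S χs
  𝔼-Xvar {m} {r} S χs = 𝔼-rowSum {m} {r} (charProd S χs)

  𝔼-Yvar : ∀ {r n} S χs → 𝔼 {r} {n} (Yvar S χs) ≡ fromℕ n * mean S χs
  𝔼-Yvar {r} {n} S χs = 𝔼-columnSum {r} {n} (charProd S χs) (charProd-cong S χs)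

  isZeroVec-cong : ∀ {r} {u v : Fin r → 𝔽} → (∀ k → u k ≡ v k) → isZeroVec u ≡ isZeroVec v
  isZeroVec-cong e = prodFin-cong (λ k → cong (λ t → 1# - χ₀ t) (e k))

  𝔼-Zvar : ∀ {m r} → 𝔼 {m} {r} Zvar ≡ fromℕ m * (Q ^ r) ⁻¹
  𝔼-Zvar {m} {r} = trans (𝔼-rowSum {m} isZeroVec) (cong (fromℕ m *_) (uniform-isZeroVec r))

  𝔼-Wvar : ∀ {r n} → 𝔼 {r} {n} Wvar ≡ fromℕ n * (Q ^ r) ⁻¹
  𝔼-Wvar {r} {n} = trans (𝔼-columnSum {r} {n} isZeroVec isZeroVec-cong) (cong (fromℕ n *_) (uniform-isZeroVec r))

  ΣSχ-coeff-XY : ∀ {m r n} A (X : Mat m r) (Y : Mat r n) →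
    ΣSχ (λ S χs → coeff A S χs * (Xvar S χs X * Yvar S χs Y)) ≡ fromℕ (ct A (X ⊗ Y))
  ΣSχ-coeff-XY A X Y = begin
    ΣSχ (λ S χs → coeff A S χs * (Xvar S χs X * Yvar S χs Y))
      ≡⟨ ΣSχ-cong (λ S χs → cong (coeff A S χs *_) (sym (cong₂ _*_ (⟪rows⟫ X (charProd S χs)) (⟪columns⟫ Y (charProd S χs))))) ⟩
    ΣSχ (λ S χs → coeff A S χs * (⟪ rows X ⟫ (charProd S χs) * ⟪ columns Y ⟫ (charProd S χs)))
      ≡⟨ coeff-bilinear A (rows X) (columns Y) ⟩
    ⟪ rows X ⟫ (λ u → ⟪ columns Y ⟫ (λ v → 𝟙A A (u ⊛ v)))
      ≡⟨ sym (ct≡⟪⟫ A X Y) ⟩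
    fromℕ (ct A (X ⊗ Y)) ∎

  ΣSχ-coeff-XE : ∀ {m r} A (X : Mat m r) →
    ΣSχ (λ S χs → coeff A S χs * (Xvar S χs X * mean S χs)) ≡ fromℕ m * α A - γA A * Zvar X
  ΣSχ-coeff-XE {m} {r} A X = begin
    ΣSχ (λ S χs → coeff A S χs * (Xvar S χs X * mean S χs))
      ≡⟨ ΣSχ-cong (λ S χs → cong (λ t → coeff A S χs * (t * mean S χs)) (sym (⟪rows⟫ X (charProd S χs)))) ⟩
    ΣSχ (λ S χs → coeff A S χs * (⟪ rows X ⟫ (charProd S χs) * mean S χs))
      ≡⟨ coeff-bilinear A (rows X) (uniform r) ⟩
    ⟪ rows X ⟫ (λ u → ⟪ uniform r ⟫ (λ v → 𝟙A A (u ⊛ v)))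
      ≡⟨ trans (⟪rows⟫ X _) (sumFin-cong {m} (λ i → uniform-𝟙A-⊛′ A (X i))) ⟩
    sumFin (λ i → α A - γA A * isZeroVec (X i))
      ≡⟨ sumFin-affine m _ _ _ ⟩
    fromℕ m * α A - γA A * Zvar X ∎

  ΣSχ-coeff-EY : ∀ {r n} A (Y : Mat r n) →
    ΣSχ (λ S χs → coeff A S χs * (mean S χs * Yvar S χs Y)) ≡ fromℕ n * α A - γA A * Wvar Y
  ΣSχ-coeff-EY {r} {n} A Y = begin
    ΣSχ (λ S χs → coeff A S χs * (mean S χs * Yvar S χs Y))
      ≡⟨ ΣSχ-cong (λ S χs → cong (λ t → coeff A S χs * (mean S χs * t)) (sym (⟪columns⟫ Y (charProd S χs)))) ⟩
    ΣSχ (λ S χs → coeff A S χs * (mean S χs * ⟪ columns Y ⟫ (charProd S χs)))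
      ≡⟨ coeff-bilinear A (uniform r) (columns Y) ⟩
    ⟪ uniform r ⟫ (λ u → ⟪ columns Y ⟫ (λ v → 𝟙A A (u ⊛ v)))
      ≡⟨ ⟪⟫-comm (uniform r) (columns Y) _ ⟩
    ⟪ columns Y ⟫ (λ v → ⟪ uniform r ⟫ (λ u → 𝟙A A (u ⊛ v)))
      ≡⟨ trans (⟪columns⟫ Y _) (sumFin-cong {n} (λ j → uniform-𝟙A-⊛ A (λ k → Y k j))) ⟩
    sumFin (λ j → α A - γA A * isZeroVec (λ k → Y k j))
      ≡⟨ sumFin-affine n _ _ _ ⟩
    fromℕ n * α A - γA A * Wvar Y ∎

  ΣSχ-coeff-EE : ∀ {r} A → ΣSχ {r} (λ S χs → coeff A S χs * (mean S χs * mean S χs)) ≡ α A - γA A * (Q ^ r) ⁻¹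
  ΣSχ-coeff-EE {r} A = begin
    ΣSχ {r} (λ S χs → coeff A S χs * (mean S χs * mean S χs))
      ≡⟨ coeff-bilinear A (uniform r) (uniform r) ⟩
    ⟪ uniform r ⟫ (λ u → ⟪ uniform r ⟫ (λ v → 𝟙A A (u ⊛ v)))
      ≡⟨ ⟪⟫-cong (uniform r) (uniform-𝟙A-⊛′ A) ⟩
    ⟪ uniform r ⟫ (λ u → α A - γA A * isZeroVec u)
      ≡⟨ ⟪⟫-- (uniform r) _ _ ⟩
    ⟪ uniform r ⟫ (λ _ → α A) - ⟪ uniform r ⟫ (λ u → γA A * isZeroVec u)
      ≡⟨ cong₂ _-_ (uniform-const r (α A)) (sym (*-distribˡ-⟪⟫ (uniform r) (γA A) isZeroVec)) ⟩
    α A - γA A * ⟪ uniform r ⟫ isZeroVec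
      ≡⟨ cong (λ t → α A - γA A * t) (uniform-isZeroVec r) ⟩
    α A - γA A * (Q ^ r) ⁻¹ ∎

  ΣSχ-combination : ∀ {r} (g₁ g₂ g₃ g₄ : Subset r → Vec (𝔽 → Carrier) r → Carrier) a b c →
    ΣSχ (λ S χs → g₁ S χs - a * g₂ S χs - b * g₃ S χs + c * g₄ S χs)
      ≡ ΣSχ g₁ - a * ΣSχ g₂ - b * ΣSχ g₃ + c * ΣSχ g₄
  ΣSχ-combination {r} g₁ g₂ g₃ g₄ a b c = begin
    ΣSχ (λ S χs → g₁₂₃ S χs + c * g₄ S χs)
      ≡⟨ ΣSχ-+ g₁₂₃ (λ S χs → c * g₄ S χs) ⟩
    ΣSχ g₁₂₃ + ΣSχ (λ S χs → c * g₄ S χs)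
      ≡⟨ cong₂ _+_ (trans (ΣSχ-- g₁₂ (λ S χs → b * g₃ S χs))
                     (cong₂ _-_ (trans (ΣSχ-- g₁ (λ S χs → a * g₂ S χs)) (cong (λ t → ΣSχ g₁ - t) (sym (*-distribˡ-ΣSχ a g₂))))
                                (sym (*-distribˡ-ΣSχ b g₃))))
                   (sym (*-distribˡ-ΣSχ c g₄)) ⟩
    ΣSχ g₁ - a * ΣSχ g₂ - b * ΣSχ g₃ + c * ΣSχ g₄ ∎
    where
    g₁₂ g₁₂₃ : Subset r → Vec (𝔽 → Carrier) r → Carrier
    g₁₂ S χs = g₁ S χs - a * g₂ S χs
    g₁₂₃ S χs = g₁₂ S χs - b * g₃ S χs

  coeff-centred-product : ∀ {m r n} A (X : Mat m r) (Y : Mat r n) S χs →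
    sumA A (λ a → hat S (fS a S) χs * (Xvar S χs X - 𝔼 {m} {r} (Xvar S χs)) * (Yvar S χs Y - 𝔼 {r} {n} (Yvar S χs)))
      ≡ coeff A S χs * (Xvar S χs X * Yvar S χs Y) - fromℕ n * (coeff A S χs * (Xvar S χs X * mean S χs))
        - fromℕ m * (coeff A S χs * (mean S χs * Yvar S χs Y)) + (fromℕ m * fromℕ n) * (coeff A S χs * (mean S χs * mean S χs))
  coeff-centred-product {m} {r} {n} A X Y S χs = begin
    sumA A (λ a → hat S (fS a S) χs * (x - 𝔼 {m} {r} (Xvar S χs)) * (y - 𝔼 {r} {n} (Yvar S χs)))
      ≡⟨ sym (*-distribʳ-sumA A _ (y - 𝔼 {r} {n} (Yvar S χs))) ⟩
    sumA A (λ a → hat S (fS a S) χs * (x - 𝔼 {m} {r} (Xvar S χs))) * (y - 𝔼 {r} {n} (Yvar S χs))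
      ≡⟨ cong (_* (y - 𝔼 {r} {n} (Yvar S χs))) (sym (*-distribʳ-sumA A (λ a → hat S (fS a S) χs) (x - 𝔼 {m} {r} (Xvar S χs)))) ⟩
    (h * (x - 𝔼 {m} {r} (Xvar S χs))) * (y - 𝔼 {r} {n} (Yvar S χs))
      ≡⟨ cong₂ (λ s t → (h * (x - s)) * (y - t)) (𝔼-Xvar {m} S χs) (𝔼-Yvar {r} {n} S χs) ⟩
    (h * (x - m′ * e)) * (y - n′ * e)
      ≡⟨ solve 6 (λ h x y e m n → (h :* (x :- m :* e)) :* (y :- n :* e)
           := h :* (x :* y) :- n :* (h :* (x :* e)) :- m :* (h :* (e :* y)) :+ (m :* n) :* (h :* (e :* e)))
           refl h x y e m′ n′ ⟩
    h * (x * y) - n′ * (h * (x * e)) - m′ * (h * (e * y)) + (m′ * n′) * (h * (e * e)) ∎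
    where
    h x y e m′ n′ : Carrier
    h = coeff A S χs
    x = Xvar S χs X
    y = Yvar S χs Y
    e = mean S χs
    m′ = fromℕ m
    n′ = fromℕ n

  fluctuation-expansion : ∀ {m r n} A (X : Mat m r) (Y : Mat r n) →
    ΣSχ (λ S χs → sumA A (λ a → hat S (fS a S) χs
      * (Xvar S χs X - 𝔼 {m} {r} (Xvar S χs)) * (Yvar S χs Y - 𝔼 {r} {n} (Yvar S χs))))
      ≡ fromℕ (ct A (X ⊗ Y)) - fromℕ n * (fromℕ m * α A - γA A * Zvar X)
        - fromℕ m * (fromℕ n * α A - γA A * Wvar Y) + (fromℕ m * fromℕ n) * (α A - γA A * (Q ^ r) ⁻¹)
  fluctuation-expansion {m} {r} {n} A X Y = begin
    ΣSχ (λ S χs → sumA A (λ a → hat S (fS a S) χs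
      * (Xvar S χs X - 𝔼 {m} {r} (Xvar S χs)) * (Yvar S χs Y - 𝔼 {r} {n} (Yvar S χs))))
      ≡⟨ ΣSχ-cong (coeff-centred-product A X Y) ⟩
    ΣSχ (λ S χs → XY S χs - n′ * XE S χs - m′ * EY S χs + (m′ * n′) * EE S χs)
      ≡⟨ ΣSχ-combination XY XE EY EE n′ m′ (m′ * n′) ⟩
    ΣSχ XY - n′ * ΣSχ XE - m′ * ΣSχ EY + (m′ * n′) * ΣSχ EE
      ≡⟨ cong₂ _+_ (cong₂ _-_ (cong₂ _-_ (ΣSχ-coeff-XY A X Y) (cong (n′ *_) (ΣSχ-coeff-XE A X)))
                              (cong (m′ *_) (ΣSχ-coeff-EY A Y)))
                   (cong ((m′ * n′) *_) (ΣSχ-coeff-EE {r} A)) ⟩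
    fromℕ (ct A (X ⊗ Y)) - n′ * (m′ * α A - γA A * Zvar X)
      - m′ * (n′ * α A - γA A * Wvar Y) + (m′ * n′) * (α A - γA A * (Q ^ r) ⁻¹) ∎
    where
    m′ n′ : Carrier
    m′ = fromℕ m
    n′ = fromℕ n
    XY XE EY EE : Subset r → Vec (𝔽 → Carrier) r → Carrier
    XY S χs = coeff A S χs * (Xvar S χs X * Yvar S χs Y)
    XE S χs = coeff A S χs * (Xvar S χs X * mean S χs)
    EY S χs = coeff A S χs * (mean S χs * Yvar S χs Y)
    EE S χs = coeff A S χs * (mean S χs * mean S χs)

lemma5p4 : (F : FiniteField) (K : Char0Field)
    (chars : List (FiniteField.Carrier F → Char0Field.Carrier K)) →
    Theory.IsCharacterGroup F K chars →
    (m n r : ℕ) → 0 < m → 0 < n → 0 < r → r ≤ m → r ≤ n →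
    (A : FiniteField.Carrier F → Bool) →
    (X : Theory.Mat F K chars m r) (Y : Theory.Mat F K chars r n) →
    let open Char0Field K
        open Theory F K chars
    in fromℕ (ct A (X ⊗ Y)) ≡
         (μA A r m n
          + sumOver (allSubsets r) (λ S → sumOver (charTuples S) (λ χs →
              sumA A (λ a →
                hat S (fS a S) χs
                * (Xvar S χs X - 𝔼 {m} {r} (Xvar S χs))
                * (Yvar S χs Y - 𝔼 {r} {n} (Yvar S χs))))))
         - (γA A * fromℕ n * (Zvar X - 𝔼 {m} {r} Zvar))
         - (γA A * fromℕ m * (Wvar Y - 𝔼 {r} {n} Wvar))
lemma5p4 F K chars isCharacterGroup m n r _ _ _ _ _ A X Y = sym (begin
  rhs T (𝔼 {m} {r} Zvar) (𝔼 {r} {n} Wvar)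
    ≡⟨ cong₂ (λ t z → rhs t z (𝔼 {r} {n} Wvar)) (fluctuation-expansion A X Y) (𝔼-Zvar {m} {r}) ⟩
  rhs (C - n′ * (m′ * α A - γᴬ * Zvar X) - m′ * (n′ * α A - γᴬ * Wvar Y) + (m′ * n′) * (α A - γᴬ * p))
      (m′ * p) (𝔼 {r} {n} Wvar)
    ≡⟨ cong (rhs _ (m′ * p)) (𝔼-Wvar {r} {n}) ⟩
  rhs (C - n′ * (m′ * α A - γᴬ * Zvar X) - m′ * (n′ * α A - γᴬ * Wvar Y) + (m′ * n′) * (α A - γᴬ * p))
      (m′ * p) (n′ * p)
    ≡⟨ solve 8 (λ C m n a g z w p →
         ((a :- g :* p) :* m :* n :+ (C :- n :* (m :* a :- g :* z) :- m :* (n :* a :- g :* w) :+ (m :* n) :* (a :- g :* p)))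
           :- g :* n :* (z :- m :* p) :- g :* m :* (w :- n :* p) := C)
         refl C m′ n′ (α A) γᴬ (Zvar X) (Wvar Y) p ⟩
  C ∎)
  where
  open CountingIdentity F K chars isCharacterGroup
  open ≡-Reasoning
  m′ n′ γᴬ p C T : Carrier
  m′ = fromℕ m
  n′ = fromℕ n
  γᴬ = γA A
  p = (Q ^ r) ⁻¹
  C = fromℕ (ct A (X ⊗ Y))
  T = ΣSχ (λ S χs → sumA A (λ a → hat S (fS a S) χs
        * (Xvar S χs X - 𝔼 {m} {r} (Xvar S χs)) * (Yvar S χs Y - 𝔼 {r} {n} (Yvar S χs))))
  rhs : Carrier → Carrier → Carrier → Carrier
  rhs t z w = (μA A r m n + t) - γᴬ * n′ * (Zvar X - z) - γᴬ * m′ * (Wvar Y - w)
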